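{- Let $k\ge2$. The generating function $\sum_{\pi}y^{N((k-1)(k-2)\dots1k;\pi)}x^{|\pi|}$, where the sum is over all $123$-avoiding permutations $\pi$, is given by the continued fraction $$\cfrac{1}{1-x\left(y^{\binom{0}{k-1}}-1\right)-\cfrac{x}{1-x\left(y^{\binom{1}{k-1}}-1\right)-\cfrac{x}{1-x\left(y^{\binom{2}{k-1}}-1\right)-\cdots}}}\ .$$
   Context: For a permutation $\pi=\pi_1\cdots\pi_n$ of $\{1,\dots,n\}$ and a permutation $\sigma=\sigma_1\cdots\sigma_m$ of $\{1,\dots,m\}$, an occurrence of the pattern $\sigma$ in $\pi$ is a choice of indices $i_1<\dots<i_m$ such that $\pi_{i_1}\cdots\pi_{i_m}$ is in the same relative order as $\sigma$; $\pi$ is $\sigma$-avoiding if there is no occurrence. $N((k-1)(k-2)\dots1k;\pi)$ is the number of occurrences in $\pi$ of the pattern $(k-1)(k-2)\dots 1k$ (the permutation of $\{1,\dots,k\}$ whose first $k-1$ entries are $k-1,k-2,\dots,1$ and whose last entry is $k$). $|\pi|$ denotes the number of elements permuted by $\pi$; the empty permutation is included. The generating function is a formal power series in $x$. -}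

module Defs where

open import Data.Bool using (Bool; true; false; _∧_; if_then_else_)
open import Data.Nat as ℕ using (ℕ; zero; suc; _∸_; _<ᵇ_; _≡ᵇ_)
open import Data.Nat.Combinatorics using (_C_)
open import Data.Integer as ℤ using (ℤ; +_; 0ℤ; 1ℤ)
open import Data.List using (List; []; _∷_; _++_; map; concatMap; length; filterᵇ; downFrom; applyUpTo)
open import Data.Bool.ListAction using (all; any)

range1 : ℕ → List ℕ
range1 n = applyUpTo suc n

words : List ℕ → ℕ → List (List ℕ)
words vs zero    = [] ∷ []
words vs (suc l) = concatMap (λ a → map (a ∷_) (words vs l)) vs

elemᵇ : ℕ → List ℕ → Bool
elemᵇ v = any (λ u → u ≡ᵇ v)

-- a word of length n over {1..n} containing every value is a permutation
isPermᵇ : ℕ → List ℕ → Bool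
isPermᵇ n π = all (λ v → elemᵇ v π) (range1 n)

perms : ℕ → List (List ℕ)
perms n = filterᵇ (isPermᵇ n) (words (range1 n) n)

-- all subsequences of length m, one per choice of indices i₁<…<iₘ
subseqs : ℕ → List ℕ → List (List ℕ)
subseqs zero    _        = [] ∷ []
subseqs (suc m) []       = []
subseqs (suc m) (a ∷ as) = map (a ∷_) (subseqs m as) ++ subseqs (suc m) as

sameCmp : ℕ → ℕ → ℕ → ℕ → Bool
sameCmp a c b d = eqB (a <ᵇ c) (b <ᵇ d) ∧ eqB (c <ᵇ a) (d <ᵇ b)
  where
  eqB : Bool → Bool → Bool
  eqB true true = true
  eqB false false = true
  eqB _ _ = false

sameOrder : List ℕ → List ℕ → Bool
sameOrder []      []      = true
sameOrder (a ∷ u) (b ∷ s) = pairs a u b s ∧ sameOrder u s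
  where
  pairs : ℕ → List ℕ → ℕ → List ℕ → Bool
  pairs a [] b [] = true
  pairs a (c ∷ u) b (d ∷ s) = sameCmp a c b d ∧ pairs a u b s
  pairs _ _ _ _ = false
sameOrder _ _ = false

occ : List ℕ → List ℕ → ℕ
occ σ π = length (filterᵇ (sameOrder σ) (subseqs (length σ) π))

pat123 : List ℕ
pat123 = 1 ∷ 2 ∷ 3 ∷ []

patK : ℕ → List ℕ
patK k = map suc (downFrom (k ∸ 1)) ++ (k ∷ [])

-- number of 123-avoiding permutations π of {1..n} with N(patK k; π) = m,
-- i.e. the coefficient of x^n y^m in the generating function
count : ℕ → ℕ → ℕ → ℕ
count k n m = length (filterᵇ (λ π → (occ pat123 π ≡ᵇ 0) ∧ (occ (patK k) π ≡ᵇ m)) (perms n))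

-- Formal power series in x, y over ℤ:  s n m = coefficient of x^n y^m

Series : Set
Series = ℕ → ℕ → ℤ

Σ≤ : ℕ → (ℕ → ℤ) → ℤ
Σ≤ zero    f = f 0
Σ≤ (suc n) f = Σ≤ n f ℤ.+ f (suc n)

zeroS : Series
zeroS _ _ = 0ℤ

oneS : Series
oneS zero zero = 1ℤ
oneS _    _    = 0ℤ

monoY : ℕ → Series
monoY c zero m = if m ≡ᵇ c then 1ℤ else 0ℤ
monoY c (suc _) _ = 0ℤ

_⊕_ : Series → Series → Series
(s ⊕ t) n m = s n m ℤ.+ t n m

_⊖_ : Series → Series → Series
(s ⊖ t) n m = s n m ℤ.- t n m

_⊗_ : Series → Series → Series
(s ⊗ t) n m = Σ≤ n λ a → Σ≤ m λ b → s a b ℤ.* t (n ∸ a) (m ∸ b)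

powS : Series → ℕ → Series
powS s zero    = oneS
powS s (suc r) = s ⊗ powS s r

-- 1 / (1 - x G) = Σ_r x^r G^r  (a formal power series in x)
geom : Series → Series
geom G n m = Σ≤ n λ r → powS G r (n ∸ r) m

-- depth-d truncation of the continued fraction starting at level j:
--   F_j = 1 / (1 - x (y^{C(j,k-1)} - 1) - x F_{j+1}),  with F_{j+d} := 0.
-- The coefficient of x^n of F_0 is the same for all depths d > n; this
-- common value is the coefficient of the infinite continued fraction.
cf : ℕ → ℕ → ℕ → Series
cf k zero    j = zeroS
cf k (suc d) j = geom ((monoY (j C (k ∸ 1)) ⊖ oneS) ⊕ cf k d (suc j))

{-# OPTIONS --safe #-}
module Submission where

-- For a 123-avoiding permutation π, let s(π) be the largest s such that 1, …, s appear in π in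
-- decreasing order.  Appending a new last entry v (shifting the values ≥ v up by one) keeps π
-- 123-avoiding exactly when v ≤ s(π) + 1, and every 123-avoiding permutation arises once this way.
-- The child has s = s(π) + 1 when v = 1 and s = v - 1 otherwise, and it gains C(v-1, k-1)
-- occurrences of (k-1)…1k, all ending at the new entry.  So 123-avoiding permutations, counted by
-- length and occurrences, are walks from level 0 that step from r up to r + 1 with weight 1 or
-- to any p ∈ {1, …, r} with weight y^C(p,k-1).  Splitting off the first step gives recurrences
-- for the series A_r of walks from level r which say that the tail F_r of the continued fraction
-- starting at level r is A_r / A_(r-1) for r ≥ 1, and hence F_0 = A_0.

open import Defs
open import Data.Nat as ℕ using (ℕ; zero; suc; _∸_; _≤_; _<_; z≤n; s≤s; _≡ᵇ_; _<ᵇ_)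
import Data.Nat.Properties as ℕP
open import Data.Nat.Combinatorics using (_C_; nCk+nC[k+1]≡[n+1]C[k+1])
open import Data.Nat.Induction using (<-rec)
open import Data.Integer using (ℤ; 0ℤ)
import Data.Integer.Properties as ℤP
open import Data.Bool using (Bool; true; false; if_then_else_; _∧_; not; T)
import Data.Bool.Properties as BP
open import Data.Bool.ListAction using (all)
open import Data.List using (List; []; _∷_; _++_; map; concat; concatMap; length; filterᵇ; downFrom)
import Data.List.Properties as LP
open import Data.List.Membership.Propositional using (_∈_; _∉_; find)
open import Data.List.Membership.Propositional.Properties
open import Data.List.Membership.Propositional.Properties.WithK using (unique∧set⇒bag)
open import Data.List.Relation.Binary.BagAndSetEquality using (∼bag⇒↭)
open import Data.List.Relation.Binary.Subset.Propositional using (_⊆_)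
open import Data.List.Relation.Unary.Any using (here; there)
import Data.List.Relation.Unary.Any as Any
import Data.List.Relation.Unary.All as All
import Data.List.Relation.Unary.All.Properties as All
import Data.List.Relation.Unary.AllPairs as AllPairs
import Data.List.Relation.Unary.AllPairs.Properties as AllPairs
open import Data.List.Relation.Unary.Unique.Propositional using (Unique; []; _∷_)
import Data.List.Relation.Unary.Unique.Propositional.Properties as Unique
open import Data.List.Relation.Binary.Permutation.Propositional
  using (_↭_; ↭-refl; ↭-trans; module PermutationReasoning)
import Data.List.Relation.Binary.Permutation.Propositional.Properties as ↭
open import Data.Product using (Σ; _×_; _,_; proj₁; proj₂; ∃₂)
open import Data.Sum using (inj₁; inj₂)
open import Data.Empty using (⊥; ⊥-elim)
open import Relation.Nullary using (yes; no)
open import Relation.Nullary.Decidable using (T?)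
open import Relation.Binary.PropositionalEquality
open import Function using (_∘_; case_of_)
open import Function.Bundles using (mk⇔; module Equivalence)

module FiniteSums where

  open import Data.Integer using (_+_; _*_; -_)
  open ≡-Reasoning

  Σ≤-cong : ∀ n {f g : ℕ → ℤ} → (∀ i → i ≤ n → f i ≡ g i) → Σ≤ n f ≡ Σ≤ n g
  Σ≤-cong zero    f≗g = f≗g 0 z≤n
  Σ≤-cong (suc n) f≗g =
    cong₂ _+_ (Σ≤-cong n (λ i i≤n → f≗g i (ℕP.m≤n⇒m≤1+n i≤n))) (f≗g (suc n) ℕP.≤-refl)

  Σ≤-distrib-+ : ∀ n (f g : ℕ → ℤ) → Σ≤ n (λ i → f i + g i) ≡ Σ≤ n f + Σ≤ n g
  Σ≤-distrib-+ zero    f g = refl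
  Σ≤-distrib-+ (suc n) f g = begin
    Σ≤ n (λ i → f i + g i) + (f (suc n) + g (suc n))
      ≡⟨ cong (_+ (f (suc n) + g (suc n))) (Σ≤-distrib-+ n f g) ⟩
    Σ≤ n f + Σ≤ n g + (f (suc n) + g (suc n))
      ≡⟨ ℤP.+-assoc (Σ≤ n f) (Σ≤ n g) _ ⟩
    Σ≤ n f + (Σ≤ n g + (f (suc n) + g (suc n)))
      ≡⟨ cong (λ z → Σ≤ n f + z) (ℤP.+-comm (Σ≤ n g) _) ⟩
    Σ≤ n f + ((f (suc n) + g (suc n)) + Σ≤ n g)
      ≡⟨ cong (λ z → Σ≤ n f + z) (ℤP.+-assoc (f (suc n)) (g (suc n)) (Σ≤ n g)) ⟩
    Σ≤ n f + (f (suc n) + (g (suc n) + Σ≤ n g))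
      ≡⟨ sym (ℤP.+-assoc (Σ≤ n f) (f (suc n)) _) ⟩
    Σ≤ (suc n) f + (g (suc n) + Σ≤ n g)
      ≡⟨ cong (λ z → Σ≤ (suc n) f + z) (ℤP.+-comm (g (suc n)) (Σ≤ n g)) ⟩
    Σ≤ (suc n) f + Σ≤ (suc n) g ∎

  *-distribˡ-Σ≤ : ∀ n c (f : ℕ → ℤ) → c * Σ≤ n f ≡ Σ≤ n (λ i → c * f i)
  *-distribˡ-Σ≤ zero    c f = refl
  *-distribˡ-Σ≤ (suc n) c f =
    trans (ℤP.*-distribˡ-+ c (Σ≤ n f) (f (suc n))) (cong (_+ c * f (suc n)) (*-distribˡ-Σ≤ n c f))

  *-distribʳ-Σ≤ : ∀ n c (f : ℕ → ℤ) → Σ≤ n f * c ≡ Σ≤ n (λ i → f i * c)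
  *-distribʳ-Σ≤ zero    c f = refl
  *-distribʳ-Σ≤ (suc n) c f =
    trans (ℤP.*-distribʳ-+ c (Σ≤ n f) (f (suc n))) (cong (_+ f (suc n) * c) (*-distribʳ-Σ≤ n c f))

  neg-distrib-Σ≤ : ∀ n (f : ℕ → ℤ) → - Σ≤ n f ≡ Σ≤ n (λ i → - f i)
  neg-distrib-Σ≤ zero    f = refl
  neg-distrib-Σ≤ (suc n) f =
    trans (ℤP.neg-distrib-+ (Σ≤ n f) (f (suc n))) (cong (_+ - f (suc n)) (neg-distrib-Σ≤ n f))

  Σ≤-suc : ∀ n (f : ℕ → ℤ) → Σ≤ (suc n) f ≡ f 0 + Σ≤ n (f ∘ suc)
  Σ≤-suc zero    f = refl
  Σ≤-suc (suc n) f =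
    trans (cong (_+ f (suc (suc n))) (Σ≤-suc n f)) (ℤP.+-assoc (f 0) (Σ≤ n (f ∘ suc)) _)

  Σ≤-zero : ∀ n (f : ℕ → ℤ) → (∀ i → i ≤ n → f i ≡ 0ℤ) → Σ≤ n f ≡ 0ℤ
  Σ≤-zero n f f≗0 = trans (Σ≤-cong n f≗0) (go n)
    where
    go : ∀ n → Σ≤ n (λ _ → 0ℤ) ≡ 0ℤ
    go zero    = refl
    go (suc n) = cong (_+ 0ℤ) (go n)

  Σ≤-head : ∀ n (f : ℕ → ℤ) → (∀ i → f (suc i) ≡ 0ℤ) → Σ≤ n f ≡ f 0
  Σ≤-head zero    f tail≡0 = refl
  Σ≤-head (suc n) f tail≡0 =
    trans (cong₂ _+_ (Σ≤-head n f tail≡0) (tail≡0 n)) (ℤP.+-identityʳ (f 0))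

  Σ≤-comm : ∀ n m (f : ℕ → ℕ → ℤ) →
            Σ≤ n (λ i → Σ≤ m (λ j → f i j)) ≡ Σ≤ m (λ j → Σ≤ n (λ i → f i j))
  Σ≤-comm zero    m f = refl
  Σ≤-comm (suc n) m f = trans (cong (_+ Σ≤ m (f (suc n))) (Σ≤-comm n m f))
                              (sym (Σ≤-distrib-+ m (λ j → Σ≤ n (λ i → f i j)) (f (suc n))))

  Σ≤-reverse : ∀ n (f : ℕ → ℤ) → Σ≤ n f ≡ Σ≤ n (λ i → f (n ∸ i))
  Σ≤-reverse zero    f = refl
  Σ≤-reverse (suc n) f = begin
    Σ≤ n f + f (suc n)                   ≡⟨ cong (_+ f (suc n)) (Σ≤-reverse n f) ⟩
    Σ≤ n (λ i → f (n ∸ i)) + f (suc n)   ≡⟨ ℤP.+-comm (Σ≤ n (λ i → f (n ∸ i))) (f (suc n)) ⟩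
    f (suc n) + Σ≤ n (λ i → f (n ∸ i))   ≡⟨ sym (Σ≤-suc n (λ i → f (suc n ∸ i))) ⟩
    Σ≤ (suc n) (λ i → f (suc n ∸ i))     ∎

  Σ≤-triangle : ∀ n (h : ℕ → ℕ → ℤ) →
    Σ≤ n (λ a → Σ≤ a (λ b → h b a)) ≡ Σ≤ n (λ b → Σ≤ (n ∸ b) (λ t → h b (b ℕ.+ t)))
  Σ≤-triangle zero    h = refl
  Σ≤-triangle (suc n) h = begin
    Σ≤ n (λ a → Σ≤ a (λ b → h b a)) + (Σ≤ n (λ b → h b (suc n)) + h (suc n) (suc n))
      ≡⟨ cong (_+ (Σ≤ n (λ b → h b (suc n)) + h (suc n) (suc n))) (Σ≤-triangle n h) ⟩
    Rows n + (Σ≤ n (λ b → h b (suc n)) + h (suc n) (suc n))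
      ≡⟨ sym (ℤP.+-assoc (Rows n) _ _) ⟩
    Rows n + Σ≤ n (λ b → h b (suc n)) + h (suc n) (suc n)
      ≡⟨ cong (_+ h (suc n) (suc n)) (sym (Σ≤-distrib-+ n _ _)) ⟩
    Σ≤ n (λ b → Row n b + h b (suc n)) + h (suc n) (suc n)
      ≡⟨ cong₂ _+_ (Σ≤-cong n extendRow) lastRow ⟩
    Σ≤ (suc n) (Row (suc n)) ∎
    where
    Row : ℕ → ℕ → ℤ
    Row n b = Σ≤ (n ∸ b) (λ t → h b (b ℕ.+ t))
    Rows : ℕ → ℤ
    Rows n = Σ≤ n (Row n)
    extendRow : ∀ b → b ≤ n → Row n b + h b (suc n) ≡ Row (suc n) b
    extendRow b b≤n rewrite ℕP.+-∸-assoc 1 b≤n | ℕP.+-suc b (n ∸ b) | ℕP.m+[n∸m]≡n b≤n = refl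
    lastRow : h (suc n) (suc n) ≡ Row (suc n) (suc n)
    lastRow rewrite ℕP.n∸n≡0 n | ℕP.+-identityʳ n = refl

  Σ≤-reindex : ∀ n (G : ℕ → ℕ → ℕ → ℤ) →
    Σ≤ n (λ a → Σ≤ a (λ a′ → G a′ (a ∸ a′) (n ∸ a)))
      ≡ Σ≤ n (λ a′ → Σ≤ (n ∸ a′) (λ x → G a′ x (n ∸ a′ ∸ x)))
  Σ≤-reindex n G = begin
    Σ≤ n (λ a → Σ≤ a (λ a′ → G a′ (a ∸ a′) (n ∸ a)))
      ≡⟨ Σ≤-triangle n (λ a′ a → G a′ (a ∸ a′) (n ∸ a)) ⟩
    Σ≤ n (λ a′ → Σ≤ (n ∸ a′) (λ x → G a′ ((a′ ℕ.+ x) ∸ a′) (n ∸ (a′ ℕ.+ x))))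
      ≡⟨ Σ≤-cong n (λ a′ _ → Σ≤-cong (n ∸ a′) (λ x _ →
           cong₂ (G a′) (ℕP.m+n∸m≡n a′ x) (sym (ℕP.∸-+-assoc n a′ x)))) ⟩
    Σ≤ n (λ a′ → Σ≤ (n ∸ a′) (λ x → G a′ x (n ∸ a′ ∸ x))) ∎

  Σ≤-comm-simplex : ∀ n (φ : ℕ → ℕ → ℤ) →
    Σ≤ n (λ r → Σ≤ (n ∸ r) (λ a → φ r a)) ≡ Σ≤ n (λ a → Σ≤ (n ∸ a) (λ r → φ r a))
  Σ≤-comm-simplex n φ = begin
    Σ≤ n (λ r → Σ≤ (n ∸ r) (λ a → φ r a))   ≡⟨ sym (Σ≤-reindex n (λ r a _ → φ r a)) ⟩
    Σ≤ n (λ s → Σ≤ s (λ r → φ r (s ∸ r)))   ≡⟨ Σ≤-cong n (λ s _ → reverseInner s) ⟩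
    Σ≤ n (λ s → Σ≤ s (λ a → φ (s ∸ a) a))   ≡⟨ Σ≤-reindex n (λ a r _ → φ r a) ⟩
    Σ≤ n (λ a → Σ≤ (n ∸ a) (λ r → φ r a))   ∎
    where
    reverseInner : ∀ s → Σ≤ s (λ r → φ r (s ∸ r)) ≡ Σ≤ s (λ a → φ (s ∸ a) a)
    reverseInner s = trans (Σ≤-reverse s (λ r → φ r (s ∸ r)))
                           (Σ≤-cong s (λ a a≤s → cong (φ (s ∸ a)) (ℕP.m∸[m∸n]≡n a≤s)))

module SeriesAlgebra where

  open import Data.Integer using (_+_; _*_; -_; _-_)
  open FiniteSums
  open ≡-Reasoning

  ∸-comm : ∀ n a b → n ∸ a ∸ b ≡ n ∸ b ∸ a
  ∸-comm n a b = begin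
    n ∸ a ∸ b     ≡⟨ ℕP.∸-+-assoc n a b ⟩
    n ∸ (a ℕ.+ b) ≡⟨ cong (n ∸_) (ℕP.+-comm a b) ⟩
    n ∸ (b ℕ.+ a) ≡⟨ ℕP.∸-+-assoc n b a ⟨
    n ∸ b ∸ a     ∎

  -- coefficient of y^m in y^c g(y), where g is given by its coefficients
  shiftY : {A : Set} → A → ℕ → (ℕ → A) → ℕ → A
  shiftY zero′ c g m = if c ℕ.≤ᵇ m then g (m ∸ c) else zero′

  shiftY-cong : ∀ {A : Set} (z : A) c {g g′ : ℕ → A} m → (∀ b → g b ≡ g′ b) →
                shiftY z c g m ≡ shiftY z c g′ m
  shiftY-cong z c m g≗g′ with c ℕ.≤ᵇ m
  ... | true  = g≗g′ (m ∸ c)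
  ... | false = refl

  ⊗-congˡ : ∀ (s s′ u : Series) n m → (∀ a b → s a b ≡ s′ a b) → (s ⊗ u) n m ≡ (s′ ⊗ u) n m
  ⊗-congˡ s s′ u n m s≗s′ =
    Σ≤-cong n (λ a _ → Σ≤-cong m (λ b _ → cong (_* u (n ∸ a) (m ∸ b)) (s≗s′ a b)))

  ⊗-congʳ : ∀ (s u u′ : Series) n m → (∀ a b → a ≤ n → b ≤ m → u a b ≡ u′ a b) →
            (s ⊗ u) n m ≡ (s ⊗ u′) n m
  ⊗-congʳ s u u′ n m u≗u′ = Σ≤-cong n (λ a _ → Σ≤-cong m (λ b _ →
    cong (s a b *_) (u≗u′ (n ∸ a) (m ∸ b) (ℕP.m∸n≤m n a) (ℕP.m∸n≤m m b))))

  ⊗-assoc : ∀ (s t u : Series) n m → ((s ⊗ t) ⊗ u) n m ≡ (s ⊗ (t ⊗ u)) n m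
  ⊗-assoc s t u n m = begin
    ((s ⊗ t) ⊗ u) n m
      ≡⟨ Σ≤-cong n (λ a _ → Σ≤-cong m (λ b _ →
           trans (*-distribʳ-Σ≤ a _ _) (Σ≤-cong a (λ a′ _ → *-distribʳ-Σ≤ b _ _)))) ⟩
    Σ≤ n (λ a → Σ≤ m (λ b → Σ≤ a (λ a′ → Σ≤ b (λ b′ → P a′ (a ∸ a′) (n ∸ a) b′ (b ∸ b′) (m ∸ b)))))
      ≡⟨ Σ≤-cong n (λ a _ → Σ≤-comm m a _) ⟩
    Σ≤ n (λ a → Σ≤ a (λ a′ → Row a′ (a ∸ a′) (n ∸ a)))
      ≡⟨ Σ≤-reindex n Row ⟩
    Σ≤ n (λ a′ → Σ≤ (n ∸ a′) (λ x → Row a′ x (n ∸ a′ ∸ x)))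
      ≡⟨ Σ≤-cong n (λ a′ _ → Σ≤-cong (n ∸ a′) (λ x _ → Σ≤-reindex m (P a′ x (n ∸ a′ ∸ x)))) ⟩
    Σ≤ n (λ a′ → Σ≤ (n ∸ a′) (λ x → Σ≤ m (λ b′ → Σ≤ (m ∸ b′) (λ y → Q a′ x b′ y))))
      ≡⟨ Σ≤-cong n (λ a′ _ → Σ≤-comm (n ∸ a′) m _) ⟩
    Σ≤ n (λ a′ → Σ≤ m (λ b′ → Σ≤ (n ∸ a′) (λ x → Σ≤ (m ∸ b′) (λ y → Q a′ x b′ y))))
      ≡⟨ Σ≤-cong n (λ a′ _ → Σ≤-cong m (λ b′ _ → sym (factor a′ b′))) ⟩
    (s ⊗ (t ⊗ u)) n m ∎
    where
    P : ℕ → ℕ → ℕ → ℕ → ℕ → ℕ → ℤ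
    P a x z b y w = s a b * t x y * u z w
    Row : ℕ → ℕ → ℕ → ℤ
    Row a′ x z = Σ≤ m (λ b → Σ≤ b (λ b′ → P a′ x z b′ (b ∸ b′) (m ∸ b)))
    Q : ℕ → ℕ → ℕ → ℕ → ℤ
    Q a′ x b′ y = P a′ x (n ∸ a′ ∸ x) b′ y (m ∸ b′ ∸ y)
    factor : ∀ a′ b′ →
      s a′ b′ * (t ⊗ u) (n ∸ a′) (m ∸ b′) ≡ Σ≤ (n ∸ a′) (λ x → Σ≤ (m ∸ b′) (λ y → Q a′ x b′ y))
    factor a′ b′ = trans (*-distribˡ-Σ≤ (n ∸ a′) (s a′ b′) _) (Σ≤-cong (n ∸ a′) (λ x _ →
      trans (*-distribˡ-Σ≤ (m ∸ b′) (s a′ b′) _) (Σ≤-cong (m ∸ b′) (λ y _ →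
        sym (ℤP.*-assoc (s a′ b′) (t x y) (u (n ∸ a′ ∸ x) (m ∸ b′ ∸ y)))))))

  ⊗-distribʳ-⊕ : ∀ (s t u : Series) n m → ((s ⊕ t) ⊗ u) n m ≡ (s ⊗ u) n m + (t ⊗ u) n m
  ⊗-distribʳ-⊕ s t u n m = trans
    (Σ≤-cong n (λ a _ → trans
      (Σ≤-cong m (λ b _ → ℤP.*-distribʳ-+ (u (n ∸ a) (m ∸ b)) (s a b) (t a b)))
      (Σ≤-distrib-+ m _ _)))
    (Σ≤-distrib-+ n _ _)

  neg-⊗ : ∀ (t u : Series) n m → ((λ a b → - t a b) ⊗ u) n m ≡ - (t ⊗ u) n m
  neg-⊗ t u n m = sym (trans (neg-distrib-Σ≤ n _) (Σ≤-cong n (λ a _ → trans (neg-distrib-Σ≤ m _)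
    (Σ≤-cong m (λ b _ → ℤP.neg-distribˡ-* (t a b) (u (n ∸ a) (m ∸ b)))))))

  ⊗-distribʳ-⊖ : ∀ (s t u : Series) n m → ((s ⊖ t) ⊗ u) n m ≡ (s ⊗ u) n m - (t ⊗ u) n m
  ⊗-distribʳ-⊖ s t u n m =
    trans (⊗-distribʳ-⊕ s (λ a b → - t a b) u n m) (cong ((s ⊗ u) n m +_) (neg-⊗ t u n m))

  Σ≤-monoY : ∀ c m (h : ℕ → ℤ) →
             Σ≤ m (λ b → monoY c 0 b * h b) ≡ (if c ℕ.≤ᵇ m then h c else 0ℤ)
  Σ≤-monoY zero    zero    h = ℤP.*-identityˡ (h 0)
  Σ≤-monoY (suc c) zero    h = refl
  Σ≤-monoY zero    (suc m) h = trans (Σ≤-head (suc m) _ (λ _ → refl)) (ℤP.*-identityˡ (h 0))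
  Σ≤-monoY (suc c) (suc m) h = trans (Σ≤-suc m _) (trans (ℤP.+-identityˡ _) (trans
    (Σ≤-monoY c m (h ∘ suc)) (cong (λ b → if b then h (suc c) else 0ℤ) (≤ᵇ-suc c m))))
    where
    ≤ᵇ-suc : ∀ c m → (c ℕ.≤ᵇ m) ≡ (suc c ℕ.≤ᵇ suc m)
    ≤ᵇ-suc zero    m = refl
    ≤ᵇ-suc (suc c) m = refl

  monoY-⊗ : ∀ c (u : Series) n m → (monoY c ⊗ u) n m ≡ shiftY 0ℤ c (u n) m
  monoY-⊗ c u n m = trans (Σ≤-head n _ (λ i → Σ≤-zero m _ (λ _ _ → refl)))
                          (Σ≤-monoY c m (λ b → u n (m ∸ b)))

  Σ≤-oneS : ∀ m (g : ℕ → ℤ) → Σ≤ m (λ b → oneS 0 b * g (m ∸ b)) ≡ g m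
  Σ≤-oneS m g = trans (Σ≤-head m _ (λ _ → refl)) (ℤP.*-identityˡ (g m))

  oneS-⊗ : ∀ (u : Series) n m → (oneS ⊗ u) n m ≡ u n m
  oneS-⊗ u n m = trans (Σ≤-head n _ (λ i → Σ≤-zero m _ (λ _ _ → refl))) (Σ≤-oneS m (u n))

  geom-suc : ∀ (G : Series) n m → geom G (suc n) m ≡ (G ⊗ geom G) n m
  geom-suc G n m = begin
    Σ≤ (suc n) (λ r → powS G r (suc n ∸ r) m)
      ≡⟨ trans (Σ≤-suc n _) (ℤP.+-identityˡ _) ⟩
    Σ≤ n (λ r → Σ≤ (n ∸ r) (λ a → Σ≤ m (λ b → G a b * powS G r (n ∸ r ∸ a) (m ∸ b))))
      ≡⟨ Σ≤-comm-simplex n (λ r a → Σ≤ m (λ b → G a b * powS G r (n ∸ r ∸ a) (m ∸ b))) ⟩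
    Σ≤ n (λ a → Σ≤ (n ∸ a) (λ r → Σ≤ m (λ b → G a b * powS G r (n ∸ r ∸ a) (m ∸ b))))
      ≡⟨ Σ≤-cong n (λ a _ → Σ≤-comm (n ∸ a) m _) ⟩
    Σ≤ n (λ a → Σ≤ m (λ b → Σ≤ (n ∸ a) (λ r → G a b * powS G r (n ∸ r ∸ a) (m ∸ b))))
      ≡⟨ Σ≤-cong n (λ a _ → Σ≤-cong m (λ b _ → sym (factor a b))) ⟩
    Σ≤ n (λ a → Σ≤ m (λ b → G a b * geom G (n ∸ a) (m ∸ b))) ∎
    where
    factor : ∀ a b → G a b * geom G (n ∸ a) (m ∸ b) ≡
                     Σ≤ (n ∸ a) (λ r → G a b * powS G r (n ∸ r ∸ a) (m ∸ b))
    factor a b = trans (*-distribˡ-Σ≤ (n ∸ a) (G a b) _) (Σ≤-cong (n ∸ a) (λ r _ →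
      cong (λ z → G a b * powS G r z (m ∸ b)) (∸-comm n a r)))

  geom-⊗-zero : ∀ (G u : Series) m → (geom G ⊗ u) 0 m ≡ u 0 m
  geom-⊗-zero G u m = Σ≤-oneS m (u 0)

  geom-⊗-suc : ∀ (G u : Series) n m →
               (geom G ⊗ u) (suc n) m ≡ u (suc n) m + ((G ⊗ geom G) ⊗ u) n m
  geom-⊗-suc G u n m = trans (Σ≤-suc n _)
    (cong₂ _+_ (Σ≤-oneS m (u (suc n))) (⊗-congˡ _ _ u n m (λ a b → geom-suc G a b)))

  level-⊗ : ∀ c (F X : Series) n m →
    (((monoY c ⊖ oneS) ⊕ F) ⊗ X) n m ≡ shiftY 0ℤ c (X n) m - X n m + (F ⊗ X) n m
  level-⊗ c F X n m = begin
    (((monoY c ⊖ oneS) ⊕ F) ⊗ X) n m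
      ≡⟨ ⊗-distribʳ-⊕ (monoY c ⊖ oneS) F X n m ⟩
    ((monoY c ⊖ oneS) ⊗ X) n m + (F ⊗ X) n m
      ≡⟨ cong (_+ (F ⊗ X) n m) (⊗-distribʳ-⊖ (monoY c) oneS X n m) ⟩
    (monoY c ⊗ X) n m - (oneS ⊗ X) n m + (F ⊗ X) n m
      ≡⟨ cong (λ z → z + (F ⊗ X) n m) (cong₂ _-_ (monoY-⊗ c X n m) (oneS-⊗ X n m)) ⟩
    shiftY 0ℤ c (X n) m - X n m + (F ⊗ X) n m ∎

module ContinuedFraction where

  open import Data.Integer using (_+_; _-_)
  open import Data.Integer.Tactic.RingSolver using (solve-∀)
  open SeriesAlgebra

  -- Series A_r satisfying the first-step recurrences of the walks from level r determine the tails
  -- of the continued fraction: F_{i+1} · A_i = A_{i+1} and F_0 = A_0, below the truncation depth.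
  module _ (k : ℕ) (weight₀≡0 : 0 C (k ∸ 1) ≡ 0) (A : ℕ → Series)
    (A-zero : ∀ r m → A r 0 m ≡ oneS 0 m)
    (A₀-suc : ∀ n m → A 0 (suc n) m ≡ A 1 n m)
    (A-suc : ∀ i n m → A (suc i) (suc n) m ≡
       A i (suc n) m + shiftY 0ℤ (suc i C (k ∸ 1)) (A (suc i) n) m - A (suc i) n m + A (suc (suc i)) n m)
    where

    IsRatio : ℕ → Set
    IsRatio n = ∀ d i m → n < d → (cf k d (suc i) ⊗ A i) n m ≡ A (suc i) n m

    ratio-step : ∀ n → (∀ {a} → a < n → IsRatio a) → IsRatio n
    ratio-step zero    _  (suc d) i m _ =
      trans (geom-⊗-zero ((monoY (suc i C (k ∸ 1)) ⊖ oneS) ⊕ cf k d (suc (suc i))) (A i) m)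
            (trans (A-zero i m) (sym (A-zero (suc i) m)))
    ratio-step (suc n) IH (suc d) i m (s≤s n<d) = begin
      (F ⊗ A i) (suc n) m
        ≡⟨ geom-⊗-suc G (A i) n m ⟩
      A i (suc n) m + ((G ⊗ F) ⊗ A i) n m
        ≡⟨ cong (A i (suc n) m +_) (⊗-assoc G F (A i) n m) ⟩
      A i (suc n) m + (G ⊗ H) n m
        ≡⟨ cong (A i (suc n) m +_) (level-⊗ c F′ H n m) ⟩
      A i (suc n) m + (shiftY 0ℤ c (H n) m - H n m + (F′ ⊗ H) n m)
        ≡⟨ cong (A i (suc n) m +_) (cong₂ _+_
             (cong₂ _-_ (shiftY-cong 0ℤ c m (H≗A n ℕP.≤-refl)) (H≗A n ℕP.≤-refl m))
             (trans (⊗-congʳ F′ H (A (suc i)) n m (λ a b a≤n _ → H≗A a a≤n b))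
                    (IH ℕP.≤-refl d (suc i) m n<d))) ⟩
      A i (suc n) m + (shiftY 0ℤ c (A (suc i) n) m - A (suc i) n m + A (suc (suc i)) n m)
        ≡⟨ reassoc (A i (suc n) m) _ _ _ ⟩
      A i (suc n) m + shiftY 0ℤ c (A (suc i) n) m - A (suc i) n m + A (suc (suc i)) n m
        ≡⟨ A-suc i n m ⟨
      A (suc i) (suc n) m ∎
      where
      open ≡-Reasoning
      c = suc i C (k ∸ 1)
      F = cf k (suc d) (suc i)
      F′ = cf k d (suc (suc i))
      G = (monoY c ⊖ oneS) ⊕ F′
      H = F ⊗ A i
      reassoc : ∀ x y z w → x + (y - z + w) ≡ x + y - z + w
      reassoc = solve-∀
      H≗A : ∀ a → a ≤ n → ∀ b → H a b ≡ A (suc i) a b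
      H≗A a a≤n b = IH (s≤s a≤n) (suc d) i b (s≤s (ℕP.≤-trans a≤n (ℕP.<⇒≤ n<d)))

    ratio : ∀ n → IsRatio n
    ratio = <-rec IsRatio ratio-step

    IsNumerator₀ : ℕ → Set
    IsNumerator₀ n = ∀ d m → n < d → cf k d 0 n m ≡ A 0 n m

    numerator₀-step : ∀ n → (∀ {a} → a < n → IsNumerator₀ a) → IsNumerator₀ n
    numerator₀-step zero    _  (suc d) m _ = sym (A-zero 0 m)
    numerator₀-step (suc n) IH (suc d) m (s≤s n<d) = begin
      F (suc n) m
        ≡⟨ geom-suc ((monoY c ⊖ oneS) ⊕ F₁) n m ⟩
      (((monoY c ⊖ oneS) ⊕ F₁) ⊗ F) n m
        ≡⟨ level-⊗ c F₁ F n m ⟩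
      shiftY 0ℤ c (F n) m - F n m + (F₁ ⊗ F) n m
        ≡⟨ cong (λ c → shiftY 0ℤ c (F n) m - F n m + (F₁ ⊗ F) n m) weight₀≡0 ⟩
      F n m - F n m + (F₁ ⊗ F) n m
        ≡⟨ trans (cong (_+ (F₁ ⊗ F) n m) (ℤP.+-inverseʳ (F n m))) (ℤP.+-identityˡ _) ⟩
      (F₁ ⊗ F) n m
        ≡⟨ ⊗-congʳ F₁ F (A 0) n m (λ a b a≤n _ →
             IH (s≤s a≤n) (suc d) b (s≤s (ℕP.≤-trans a≤n (ℕP.<⇒≤ n<d)))) ⟩
      (F₁ ⊗ A 0) n m
        ≡⟨ ratio n d 0 m n<d ⟩
      A 1 n m
        ≡⟨ A₀-suc n m ⟨
      A 0 (suc n) m ∎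
      where
      open ≡-Reasoning
      c = 0 C (k ∸ 1)
      F = cf k (suc d) 0
      F₁ = cf k d 1

    cf≡A₀ : ∀ n m d → n < d → cf k d 0 n m ≡ A 0 n m
    cf≡A₀ n m d = <-rec IsNumerator₀ numerator₀-step n d m

module Counting where

  open import Data.Nat using (_+_)

  countᵇ : {A : Set} → (A → Bool) → List A → ℕ
  countᵇ p xs = length (filterᵇ p xs)

  module _ {A : Set} (p : A → Bool) where

    countᵇ-∷ : ∀ x xs → countᵇ p (x ∷ xs) ≡ (if p x then 1 else 0) + countᵇ p xs
    countᵇ-∷ x xs with p x
    ... | true  = refl
    ... | false = refl

    countᵇ-++ : ∀ xs ys → countᵇ p (xs ++ ys) ≡ countᵇ p xs + countᵇ p ys
    countᵇ-++ xs ys = trans (cong length (LP.filter-++ (T? ∘ p) xs ys)) (LP.length-++ (filterᵇ p xs))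

    countᵇ-map : {B : Set} (f : B → A) → ∀ xs → countᵇ p (map f xs) ≡ countᵇ (p ∘ f) xs
    countᵇ-map f []       = refl
    countᵇ-map f (x ∷ xs) with p (f x)
    ... | true  = cong suc (countᵇ-map f xs)
    ... | false = countᵇ-map f xs

    countᵇ-↭ : ∀ {xs ys} → xs ↭ ys → countᵇ p xs ≡ countᵇ p ys
    countᵇ-↭ xs↭ys = ↭.↭-length (↭.filter-↭ (T? ∘ p) xs↭ys)

  countᵇ-cong : {A : Set} (p q : A → Bool) → ∀ xs → (∀ {x} → x ∈ xs → p x ≡ q x) →
                countᵇ p xs ≡ countᵇ q xs
  countᵇ-cong p q []       p≗q = refl
  countᵇ-cong p q (x ∷ xs) p≗q
    rewrite countᵇ-∷ p x xs | countᵇ-∷ q x xs | p≗q (here refl) | countᵇ-cong p q xs (p≗q ∘ there)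
    = refl

  countᵇ-none : {A : Set} (p : A → Bool) → ∀ xs → (∀ x → p x ≡ false) → countᵇ p xs ≡ 0
  countᵇ-none p []       _   = refl
  countᵇ-none p (x ∷ xs) p≡f rewrite countᵇ-∷ p x xs | p≡f x = countᵇ-none p xs p≡f

module Walks where

  open import Data.Nat using (_+_)
  open Counting
  open SeriesAlgebra using (shiftY)

  weight : ℕ → ℕ → ℕ
  weight k p = p C (k ∸ 1)

  levels : ℕ → List ℕ
  levels r = map suc (downFrom r)

  -- A walk is recorded by its final level and its total weight, the exponent of y.
  steps : ℕ → ℕ → List (ℕ × ℕ)
  steps k r = (suc r , 0) ∷ map (λ p → p , weight k p) (levels r)

  addWeight : ℕ → ℕ × ℕ → ℕ × ℕ
  addWeight w (p , v) = p , w + v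

  continue : (ℕ → List (ℕ × ℕ)) → List (ℕ × ℕ) → List (ℕ × ℕ)
  continue next = concatMap (λ e → map (addWeight (proj₂ e)) (next (proj₁ e)))

  walks : ℕ → ℕ → ℕ → List (ℕ × ℕ)
  walks k r zero    = (r , 0) ∷ []
  walks k r (suc n) = continue (λ p → walks k p n) (steps k r)

  addWeight-∘ : ∀ w v xs → map (addWeight w) (map (addWeight v) xs) ≡ map (addWeight (w + v)) xs
  addWeight-∘ w v xs = trans (sym (LP.map-∘ xs))
    (LP.map-cong (λ e → cong (proj₁ e ,_) (sym (ℕP.+-assoc w v (proj₂ e)))) xs)

  continue-cong : ∀ {f g} → (∀ p → f p ≡ g p) → ∀ xs → continue f xs ≡ continue g xs
  continue-cong f≗g = LP.concatMap-cong (λ e → cong (map (addWeight (proj₂ e))) (f≗g (proj₁ e)))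

  continue-addWeight : ∀ next w ys →
    continue next (map (addWeight w) ys) ≡ map (addWeight w) (continue next ys)
  continue-addWeight next w []       = refl
  continue-addWeight next w (y ∷ ys) = begin
    map (addWeight (w + proj₂ y)) (next (proj₁ y)) ++ continue next (map (addWeight w) ys)
      ≡⟨ cong₂ _++_ (sym (addWeight-∘ w (proj₂ y) (next (proj₁ y)))) (continue-addWeight next w ys) ⟩
    map (addWeight w) (map (addWeight (proj₂ y)) (next (proj₁ y))) ++ map (addWeight w) (continue next ys)
      ≡⟨ LP.map-++ (addWeight w) _ (continue next ys) ⟨
    map (addWeight w) (continue next (y ∷ ys)) ∎
    where open ≡-Reasoning

  continue-assoc : ∀ f g xs → continue f (continue g xs) ≡ continue (continue f ∘ g) xs
  continue-assoc f g []       = refl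
  continue-assoc f g (x ∷ xs) =
    trans (LP.concatMap-++ _ (map (addWeight (proj₂ x)) (g (proj₁ x))) (continue g xs))
          (cong₂ _++_ (continue-addWeight f (proj₂ x) (g (proj₁ x))) (continue-assoc f g xs))

  continue-unitˡ : ∀ next p → continue next ((p , 0) ∷ []) ≡ next p
  continue-unitˡ next p = trans (LP.++-identityʳ _) (LP.map-id (next p))

  continue-unitʳ : ∀ xs → continue (λ p → (p , 0) ∷ []) xs ≡ xs
  continue-unitʳ []       = refl
  continue-unitʳ (x ∷ xs) = cong₂ _∷_ (cong (proj₁ x ,_) (ℕP.+-identityʳ (proj₂ x))) (continue-unitʳ xs)

  walks-suc : ∀ k r n → walks k r (suc n) ≡ continue (steps k) (walks k r n)
  walks-suc k r zero    = trans (continue-unitʳ (steps k r)) (sym (continue-unitˡ (steps k) r))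
  walks-suc k r (suc n) = trans (continue-cong (λ p → walks-suc k p n) (steps k r))
                                (sym (continue-assoc (steps k) (λ p → walks k p n) (steps k r)))

  hasWeight : ℕ → ℕ × ℕ → Bool
  hasWeight m e = proj₂ e ≡ᵇ m

  walkCount : ℕ → ℕ → ℕ → ℕ → ℕ
  walkCount k r n m = countᵇ (hasWeight m) (walks k r n)

  +-≡ᵇ : ∀ c w m → (c + w ≡ᵇ m) ≡ (if c ℕ.≤ᵇ m then (w ≡ᵇ m ∸ c) else false)
  +-≡ᵇ zero          w m       = refl
  +-≡ᵇ (suc c)       w zero    = refl
  +-≡ᵇ (suc zero)    w (suc m) = refl
  +-≡ᵇ (suc (suc c)) w (suc m) = +-≡ᵇ (suc c) w m

  countᵇ-addWeight : ∀ c W m → countᵇ (hasWeight m) (map (addWeight c) W) ≡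
                                shiftY 0 c (λ m′ → countᵇ (hasWeight m′) W) m
  countᵇ-addWeight c W m rewrite countᵇ-map (hasWeight m) (addWeight c) W with c ℕ.≤ᵇ m in c≤m
  ... | true  = countᵇ-cong _ _ W (λ {e} _ → trans (+-≡ᵇ c (proj₂ e) m)
                  (cong (λ b → if b then (proj₂ e ≡ᵇ m ∸ c) else false) c≤m))
  ... | false = countᵇ-none _ W (λ e → trans (+-≡ᵇ c (proj₂ e) m)
                  (cong (λ b → if b then (proj₂ e ≡ᵇ m ∸ c) else false) c≤m))

  -- walks of length n + 1 and weight m from level r whose first step does not go up
  downCount : ℕ → ℕ → ℕ → ℕ → ℕ
  downCount k zero    n m = 0
  downCount k (suc p) n m = shiftY 0 (weight k (suc p)) (walkCount k (suc p) n) m + downCount k p n m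

  walkCount-suc : ∀ k r n m → walkCount k r (suc n) m ≡ walkCount k (suc r) n m + downCount k r n m
  walkCount-suc k r n m =
    trans (countᵇ-++ (hasWeight m) (map (addWeight 0) (walks k (suc r) n)) _)
          (cong₂ _+_ (countᵇ-addWeight 0 (walks k (suc r) n) m) (downSteps r))
    where
    downSteps : ∀ r →
      countᵇ (hasWeight m) (continue (λ p → walks k p n) (map (λ p → p , weight k p) (levels r))) ≡ downCount k r n m
    downSteps zero    = refl
    downSteps (suc p) =
      trans (countᵇ-++ (hasWeight m) (map (addWeight (weight k (suc p))) (walks k (suc p) n)) _)
            (cong₂ _+_ (countᵇ-addWeight (weight k (suc p)) (walks k (suc p) n) m) (downSteps p))

module WalkSeries where

  open import Data.Integer using (+_; _+_; _-_)
  open import Data.Integer.Tactic.RingSolver using (solve-∀)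
  open Walks
  open SeriesAlgebra using (shiftY)

  walkSeries : ℕ → ℕ → Series
  walkSeries k r n m = + walkCount k r n m

  walkSeries-zero : ∀ k r m → walkSeries k r 0 m ≡ oneS 0 m
  walkSeries-zero k r zero    = refl
  walkSeries-zero k r (suc m) = refl

  walkSeries₀-suc : ∀ k n m → walkSeries k 0 (suc n) m ≡ walkSeries k 1 n m
  walkSeries₀-suc k n m = cong +_ (trans (walkCount-suc k 0 n m) (ℕP.+-identityʳ _))

  shiftY-+ : ∀ c g m → shiftY 0ℤ c (λ b → + g b) m ≡ + shiftY 0 c g m
  shiftY-+ c g m with c ℕ.≤ᵇ m
  ... | true  = refl
  ... | false = refl

  walkSeries-suc : ∀ k i n m → walkSeries k (suc i) (suc n) m ≡
     walkSeries k i (suc n) m + shiftY 0ℤ (suc i C (k ∸ 1)) (walkSeries k (suc i) n) m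
       - walkSeries k (suc i) n m + walkSeries k (suc (suc i)) n m
  walkSeries-suc k i n m = begin
    + walkCount k (suc i) (suc n) m
      ≡⟨ cong +_ (walkCount-suc k (suc i) n m) ⟩
    + (a ℕ.+ (s ℕ.+ d))
      ≡⟨ trans (ℤP.pos-+ a (s ℕ.+ d)) (cong (_+_ (+ a)) (ℤP.pos-+ s d)) ⟩
    + a + (+ s + + d)
      ≡⟨ rearrange (+ a) (+ s) (+ d) (+ b) ⟩
    + b + + d + + s - + b + + a
      ≡⟨ cong₂ (λ x y → x + y - + b + + a)
           (trans (sym (ℤP.pos-+ b d)) (cong +_ (sym (walkCount-suc k i n m))))
           (sym (shiftY-+ (weight k (suc i)) (walkCount k (suc i) n) m)) ⟩
    walkSeries k i (suc n) m + shiftY 0ℤ (suc i C (k ∸ 1)) (walkSeries k (suc i) n) m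
      - walkSeries k (suc i) n m + walkSeries k (suc (suc i)) n m ∎
    where
    open ≡-Reasoning
    a = walkCount k (suc (suc i)) n m
    b = walkCount k (suc i) n m
    s = shiftY 0 (weight k (suc i)) (walkCount k (suc i) n) m
    d = downCount k i n m
    rearrange : ∀ a s d b → a + (s + d) ≡ b + d + s - b + a
    rearrange = solve-∀

module Booleans where

  ∧-true⁻ : ∀ {a b} → (a ∧ b) ≡ true → a ≡ true × b ≡ true
  ∧-true⁻ {true} {true} _ = refl , refl

  ∧-interchange : ∀ a b c d → ((a ∧ b) ∧ (c ∧ d)) ≡ ((a ∧ c) ∧ (b ∧ d))
  ∧-interchange true  true  c d = refl
  ∧-interchange true  false c d = sym (BP.∧-zeroʳ c)
  ∧-interchange false b     c d = refl

  ≡ᵇ-true⁻ : ∀ {m n} → (m ≡ᵇ n) ≡ true → m ≡ n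
  ≡ᵇ-true⁻ {m} {n} e = ℕP.≡ᵇ⇒≡ m n (subst T (sym e) _)

  ≡ᵇ-refl : ∀ m → (m ≡ᵇ m) ≡ true
  ≡ᵇ-refl zero    = refl
  ≡ᵇ-refl (suc m) = ≡ᵇ-refl m

  <ᵇ-true : ∀ {a b} → a < b → (a <ᵇ b) ≡ true
  <ᵇ-true {zero}  {suc b} _         = refl
  <ᵇ-true {suc a} {suc b} (s≤s a<b) = <ᵇ-true a<b

  <ᵇ-false : ∀ {a b} → b ≤ a → (a <ᵇ b) ≡ false
  <ᵇ-false {a}     {zero}  _         = refl
  <ᵇ-false {suc a} {suc b} (s≤s b≤a) = <ᵇ-false b≤a

  <ᵇ-true⁻ : ∀ {a b} → (a <ᵇ b) ≡ true → a < b
  <ᵇ-true⁻ {zero}  {suc b} _ = s≤s z≤n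
  <ᵇ-true⁻ {suc a} {suc b} e = s≤s (<ᵇ-true⁻ e)

  <ᵇ-false⁻ : ∀ {a b} → (a <ᵇ b) ≡ false → b ≤ a
  <ᵇ-false⁻ {a}     {zero}  _ = z≤n
  <ᵇ-false⁻ {suc a} {suc b} e = s≤s (<ᵇ-false⁻ e)

  <ᵇ-asym : ∀ {a b} → (a <ᵇ b) ≡ true → (b <ᵇ a) ≡ false
  <ᵇ-asym {a} {b} e = <ᵇ-false (ℕP.<⇒≤ (<ᵇ-true⁻ {a} {b} e))

  all⁺ : {A : Set} (p : A → Bool) {xs : List A} → (∀ {x} → x ∈ xs → p x ≡ true) → all p xs ≡ true
  all⁺ p {[]}     _   = refl
  all⁺ p {y ∷ ys} p≡t rewrite p≡t (here refl) = all⁺ p (p≡t ∘ there)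

  all⁻ : {A : Set} (p : A → Bool) {xs : List A} → all p xs ≡ true → ∀ {x} → x ∈ xs → p x ≡ true
  all⁻ p {y ∷ ys} e (here refl) = proj₁ (∧-true⁻ e)
  all⁻ p {y ∷ ys} e (there x∈)  = all⁻ p (proj₂ (∧-true⁻ {p y} e)) x∈

module ListFacts where

  open import Data.Nat using (_+_)
  open Counting
  open Booleans

  module _ {A : Set} (p : A → Bool) where

    filterᵇ-∷ : ∀ x xs → filterᵇ p (x ∷ xs) ≡ (if p x then x ∷ filterᵇ p xs else filterᵇ p xs)
    filterᵇ-∷ x xs with p x
    ... | true  = refl
    ... | false = refl

    ∈-filterᵇ⁺ : ∀ {x xs} → x ∈ xs → p x ≡ true → x ∈ filterᵇ p xs
    ∈-filterᵇ⁺ x∈ px = ∈-filter⁺ (T? ∘ p) x∈ (subst T (sym px) _)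

    ∈-filterᵇ⁻ : ∀ {x xs} → x ∈ filterᵇ p xs → x ∈ xs × p x ≡ true
    ∈-filterᵇ⁻ x∈ with ∈-filter⁻ (T? ∘ p) x∈
    ... | x∈xs , px = x∈xs , Equivalence.to BP.T-≡ px

    countᵇ-all : ∀ xs → (∀ {x} → x ∈ xs → p x ≡ true) → countᵇ p xs ≡ length xs
    countᵇ-all []       _   = refl
    countᵇ-all (x ∷ xs) p≡t rewrite countᵇ-∷ p x xs | p≡t (here refl) =
      cong suc (countᵇ-all xs (p≡t ∘ there))

  countᵇ-∧ : {A : Set} (p q : A → Bool) → ∀ xs →
             countᵇ (λ x → p x ∧ q x) xs ≡ countᵇ q (filterᵇ p xs)
  countᵇ-∧ p q []       = refl
  countᵇ-∧ p q (x ∷ xs) rewrite filterᵇ-∷ p x xs | countᵇ-∷ (λ x → p x ∧ q x) x xs with p x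
  ... | true  rewrite countᵇ-∷ q x (filterᵇ p xs) = cong ((if q x then 1 else 0) +_) (countᵇ-∧ p q xs)
  ... | false = countᵇ-∧ p q xs

  module _ {A : Set} where

    ∈-drop-mid : ∀ {s t : A} ys zs → t ∈ ys ++ s ∷ zs → t ≢ s → t ∈ ys ++ zs
    ∈-drop-mid []       zs (here refl) t≢s = ⊥-elim (t≢s refl)
    ∈-drop-mid []       zs (there t∈)  _   = t∈
    ∈-drop-mid (y ∷ ys) zs (here refl) _   = here refl
    ∈-drop-mid (y ∷ ys) zs (there t∈)  t≢s = there (∈-drop-mid ys zs t∈ t≢s)

    ∈-insert-mid : ∀ {s t : A} ys zs → t ∈ ys ++ zs → t ∈ ys ++ s ∷ zs
    ∈-insert-mid []       zs t∈          = there t∈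
    ∈-insert-mid (y ∷ ys) zs (here refl) = here refl
    ∈-insert-mid (y ∷ ys) zs (there t∈)  = there (∈-insert-mid ys zs t∈)

    unique-drop-mid : ∀ {s : A} ys zs → Unique (ys ++ s ∷ zs) → Unique (ys ++ zs) × s ∉ ys ++ zs
    unique-drop-mid []       zs (s∉ ∷ u) = u , λ s∈ → All.lookup s∉ s∈ refl
    unique-drop-mid (y ∷ ys) zs (y∉ ∷ u) with unique-drop-mid ys zs u
    ... | u′ , s∉ = All.tabulate (λ t∈ → All.lookup y∉ (∈-insert-mid ys zs t∈)) ∷ u′ ,
                    λ { (here refl) → All.lookup y∉ (∈-++⁺ʳ ys (here refl)) refl ; (there s∈) → s∉ s∈ }

    ↭-fromMembers : ∀ {xs ys : List A} → Unique xs → Unique ys → xs ⊆ ys → ys ⊆ xs → xs ↭ ys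
    ↭-fromMembers uxs uys xs⊆ys ys⊆xs = ∼bag⇒↭ (unique∧set⇒bag uxs uys (mk⇔ xs⊆ys ys⊆xs))

    length-⊆ : ∀ {xs ys : List A} → Unique xs → xs ⊆ ys → length xs ≤ length ys
    length-⊆ {[]}     _          _     = z≤n
    length-⊆ {s ∷ xs} {ys} (s∉ ∷ u) s∷xs⊆ys with ∈-∃++ (s∷xs⊆ys (here refl))
    ... | as , bs , refl = ℕP.≤-trans
      (s≤s (length-⊆ u (λ t∈ →
        ∈-drop-mid as bs (s∷xs⊆ys (there t∈)) (λ { refl → All.lookup s∉ t∈ refl }))))
      (ℕP.≤-reflexive (sym (LP.length-++-sucʳ as s bs)))

    unique-concatMap : {B : Set} (f : A → List B) → ∀ {xs} → Unique xs → (∀ x → Unique (f x)) →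
      (∀ {x y z} → z ∈ f x → z ∈ f y → x ≡ y) → Unique (concatMap f xs)
    unique-concatMap f uxs uf disjoint = Unique.concat⁺ (All.map⁺ (All.tabulate (λ {x} _ → uf x)))
      (AllPairs.map⁺ {f = f}
        (AllPairs.map (λ x≢y → λ { (z∈fx , z∈fy) → x≢y (disjoint z∈fx z∈fy) }) uxs))

    concatMap-↭ : {B : Set} (f : A → List B) {xs ys : List A} → xs ↭ ys → concatMap f xs ↭ concatMap f ys
    concatMap-↭ f _↭_.refl           = ↭-refl
    concatMap-↭ f (_↭_.prep x p)     = ↭.++⁺ˡ (f x) (concatMap-↭ f p)
    concatMap-↭ f (_↭_.swap x y p)   =
      ↭-trans (↭.shifts (f x) (f y)) (↭.++⁺ˡ (f y) (↭.++⁺ˡ (f x) (concatMap-↭ f p)))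
    concatMap-↭ f (_↭_.trans p q)    = ↭-trans (concatMap-↭ f p) (concatMap-↭ f q)

    snoc-view : ∀ {n} (xs : List A) → length xs ≡ suc n → ∃₂ λ ys v → xs ≡ ys ++ v ∷ []
    snoc-view (x ∷ [])    _                       = [] , x , refl
    snoc-view {suc n} (x ∷ y ∷ r) len with snoc-view {n} (y ∷ r) (ℕP.suc-injective len)
    ... | ys , v , eq = x ∷ ys , v , cong (x ∷_) eq

    map-cong-∈ : {B : Set} {f g : A → B} → ∀ xs → (∀ {x} → x ∈ xs → f x ≡ g x) → map f xs ≡ map g xs
    map-cong-∈ []       _   = refl
    map-cong-∈ (x ∷ xs) f≗g = cong₂ _∷_ (f≗g (here refl)) (map-cong-∈ xs (f≗g ∘ there))

  open import Data.List.Membership.DecPropositional ℕ._≟_ using (_∈?_)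

  pigeonhole : ∀ {S xs : List ℕ} → Unique S → S ⊆ xs → length xs ≤ length S → Unique xs
  pigeonhole {S} {[]}     _  _    _   = []
  pigeonhole {S} {a ∷ xs} uS S⊆ len =
    All.tabulate (λ b∈ a≡b → a∉xs (subst (_∈ xs) (sym a≡b) b∈)) ∷ unique-xs
    where
    tooLong : S ⊆ xs → ⊥
    tooLong S⊆xs = ℕP.<-irrefl refl (ℕP.≤-trans len (length-⊆ uS S⊆xs))
    a∉xs : a ∉ xs
    a∉xs a∈xs = tooLong (λ s∈ → case S⊆ s∈ of λ { (here refl) → a∈xs ; (there t∈) → t∈ })
    unique-xs : Unique xs
    unique-xs with a ∈? S
    ... | no a∉S = ⊥-elim (tooLong (λ s∈ → Any.tail (λ { refl → a∉S s∈ }) (S⊆ s∈)))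
    ... | yes a∈S with ∈-∃++ a∈S
    ...   | as , bs , refl with unique-drop-mid as bs uS
    ...     | u′ , a∉′ = pigeonhole u′
                (λ t∈ → Any.tail (λ { refl → a∉′ t∈ }) (S⊆ (∈-insert-mid as bs t∈)))
                (ℕP.≤-pred (ℕP.≤-trans len (ℕP.≤-reflexive (LP.length-++-sucʳ as a bs))))

module Permutations where

  open Booleans
  open ListFacts

  ∈-range1⁺ : ∀ {t n} → 1 ≤ t → t ≤ n → t ∈ range1 n
  ∈-range1⁺ {suc i} (s≤s _) i<n = ∈-applyUpTo⁺ suc i<n

  ∈-range1⁻ : ∀ {t n} → t ∈ range1 n → 1 ≤ t × t ≤ n
  ∈-range1⁻ t∈ with ∈-applyUpTo⁻ suc t∈
  ... | i , i<n , refl = s≤s z≤n , i<n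

  unique-range1 : ∀ n → Unique (range1 n)
  unique-range1 n = Unique.applyUpTo⁺₁ suc n (λ i<j _ e → ℕP.<⇒≢ i<j (ℕP.suc-injective e))

  length-range1 : ∀ n → length (range1 n) ≡ n
  length-range1 n = LP.length-applyUpTo suc n

  ∈-words⁻ : ∀ V l {w} → w ∈ words V l → length w ≡ l × w ⊆ V
  ∈-words⁻ V zero    (here refl) = refl , λ ()
  ∈-words⁻ V (suc l) w∈ with find (∈-concatMap⁻ (λ a → map (a ∷_) (words V l)) {xs = V} w∈)
  ... | b , b∈V , w∈′ with ∈-map⁻ (b ∷_) w∈′
  ... | w , w∈ , refl with ∈-words⁻ V l w∈
  ... | len , w⊆V = cong suc len , λ { (here refl) → b∈V ; (there a∈) → w⊆V a∈ }

  ∈-words⁺ : ∀ V l {w} → length w ≡ l → w ⊆ V → w ∈ words V l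
  ∈-words⁺ V zero    {[]}    _   _   = here refl
  ∈-words⁺ V (suc l) {a ∷ w} len w⊆V = ∈-concatMap⁺ (λ b → map (b ∷_) (words V l))
    (Any.map (λ { refl → ∈-map⁺ (a ∷_) (∈-words⁺ V l (ℕP.suc-injective len) (w⊆V ∘ there)) })
             (w⊆V (here refl)))

  unique-words : ∀ {V} l → Unique V → Unique (words V l)
  unique-words zero    _  = All.[] ∷ []
  unique-words {V} (suc l) uV = unique-concatMap (λ b → map (b ∷_) (words V l)) uV
    (λ b → Unique.map⁺ (λ e → proj₂ (LP.∷-injective e)) (unique-words l uV))
    (λ {a} {b} z∈ z∈′ → case ∈-map⁻ (a ∷_) z∈ , ∈-map⁻ (b ∷_) z∈′ of λ
      { ((_ , _ , refl) , (_ , _ , eq)) → proj₁ (LP.∷-injective eq) })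

  elemᵇ⁺ : ∀ {v xs} → v ∈ xs → elemᵇ v xs ≡ true
  elemᵇ⁺ {v}          (here refl) rewrite ≡ᵇ-refl v = refl
  elemᵇ⁺ {v} {u ∷ us} (there v∈)  rewrite elemᵇ⁺ v∈ = BP.∨-zeroʳ (u ≡ᵇ v)

  elemᵇ⁻ : ∀ {v xs} → elemᵇ v xs ≡ true → v ∈ xs
  elemᵇ⁻ {v} {u ∷ us} e with u ≡ᵇ v in u≡v
  ... | true  = here (sym (≡ᵇ-true⁻ u≡v))
  ... | false = there (elemᵇ⁻ e)

  record IsPerm (n : ℕ) (π : List ℕ) : Set where
    field
      length≡ : length π ≡ n
      values  : π ⊆ range1 n
      covers  : range1 n ⊆ π

    unique : Unique π
    unique = pigeonhole (unique-range1 n) covers (ℕP.≤-reflexive (trans length≡ (sym (length-range1 n))))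

  open IsPerm public

  ∈-perms⁻ : ∀ {n π} → π ∈ perms n → IsPerm n π
  ∈-perms⁻ {n} {π} π∈ with ∈-filterᵇ⁻ (isPermᵇ n) π∈
  ... | π∈words , isPerm with ∈-words⁻ (range1 n) n π∈words
  ... | len , π⊆ = record
    { length≡ = len ; values = π⊆ ; covers = λ t∈ → elemᵇ⁻ (all⁻ (λ v → elemᵇ v π) isPerm t∈) }

  ∈-perms⁺ : ∀ {n π} → IsPerm n π → π ∈ perms n
  ∈-perms⁺ {n} p = ∈-filterᵇ⁺ (isPermᵇ n) (∈-words⁺ (range1 n) n (length≡ p) (values p))
                     (all⁺ _ (λ t∈ → elemᵇ⁺ (covers p t∈)))

  unique-perms : ∀ n → Unique (perms n)
  unique-perms n = Unique.filter⁺ (T? ∘ isPermᵇ n) (unique-words n (unique-range1 n))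

module Insertion where

  open import Data.Nat using (_+_)
  open Booleans
  open ListFacts
  open Permutations

  punchIn : ℕ → ℕ → ℕ
  punchIn v a = if a <ᵇ v then a else suc a

  punchOut : ℕ → ℕ → ℕ
  punchOut v a = if a <ᵇ v then a else a ∸ 1

  insertLast : ℕ → List ℕ → List ℕ
  insertLast v π = map (punchIn v) π ++ v ∷ []

  punchIn-< : ∀ {v a} → a < v → punchIn v a ≡ a
  punchIn-< a<v rewrite <ᵇ-true a<v = refl

  punchIn-≥ : ∀ {v a} → v ≤ a → punchIn v a ≡ suc a
  punchIn-≥ v≤a rewrite <ᵇ-false v≤a = refl

  punchOut-< : ∀ {v a} → a < v → punchOut v a ≡ a
  punchOut-< a<v rewrite <ᵇ-true a<v = refl

  punchOut-≥ : ∀ {v a} → v ≤ a → punchOut v a ≡ a ∸ 1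
  punchOut-≥ v≤a rewrite <ᵇ-false v≤a = refl

  punchOut-punchIn : ∀ v a → punchOut v (punchIn v a) ≡ a
  punchOut-punchIn v a with a ℕ.<? v
  ... | yes a<v rewrite punchIn-< a<v = punchOut-< a<v
  ... | no  a≮v rewrite punchIn-≥ (ℕP.≮⇒≥ a≮v) = punchOut-≥ (ℕP.m≤n⇒m≤1+n (ℕP.≮⇒≥ a≮v))

  punchIn-punchOut : ∀ v a → a ≢ v → punchIn v (punchOut v a) ≡ a
  punchIn-punchOut v a a≢v with a ℕ.<? v
  ... | yes a<v rewrite punchOut-< a<v = punchIn-< a<v
  ... | no  a≮v with ℕP.≤∧≢⇒< (ℕP.≮⇒≥ a≮v) (a≢v ∘ sym)
  ...   | s≤s {n = a′} v≤a′ rewrite punchOut-≥ (ℕP.≮⇒≥ a≮v) = punchIn-≥ v≤a′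

  punchIn-injective : ∀ v {a b} → punchIn v a ≡ punchIn v b → a ≡ b
  punchIn-injective v {a} {b} eq =
    trans (sym (punchOut-punchIn v a)) (trans (cong (punchOut v) eq) (punchOut-punchIn v b))

  punchIn≢ : ∀ v a → punchIn v a ≢ v
  punchIn≢ v a with a ℕ.<? v
  ... | yes a<v rewrite punchIn-< a<v = λ { refl → ℕP.<-irrefl refl a<v }
  ... | no  a≮v rewrite punchIn-≥ (ℕP.≮⇒≥ a≮v) = λ { refl → ℕP.<-irrefl refl (s≤s (ℕP.≮⇒≥ a≮v)) }

  punchIn-<ᵇ : ∀ v a c → (punchIn v a <ᵇ punchIn v c) ≡ (a <ᵇ c)
  punchIn-<ᵇ v a c with a ℕ.<? v | c ℕ.<? v
  ... | yes a<v | yes c<v rewrite punchIn-< a<v | punchIn-< c<v = refl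
  ... | yes a<v | no  c≮v rewrite punchIn-< a<v | punchIn-≥ (ℕP.≮⇒≥ c≮v)
    = trans (<ᵇ-true (ℕP.m<n⇒m<1+n a<c)) (sym (<ᵇ-true a<c))
    where a<c = ℕP.<-≤-trans a<v (ℕP.≮⇒≥ c≮v)
  ... | no  a≮v | yes c<v rewrite punchIn-< c<v | punchIn-≥ (ℕP.≮⇒≥ a≮v)
    = trans (<ᵇ-false (ℕP.m≤n⇒m≤1+n c≤a)) (sym (<ᵇ-false c≤a))
    where c≤a = ℕP.<⇒≤ (ℕP.<-≤-trans c<v (ℕP.≮⇒≥ a≮v))
  ... | no  a≮v | no  c≮v rewrite punchIn-≥ (ℕP.≮⇒≥ a≮v) | punchIn-≥ (ℕP.≮⇒≥ c≮v) = refl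

  punchOut-range : ∀ {n v a} → 1 ≤ v → v ≤ suc n → a ∈ range1 (suc n) → a ≢ v →
                   punchOut v a ∈ range1 n
  punchOut-range {n} {v} {a} 1≤v v≤ a∈ a≢v with ∈-range1⁻ a∈ | a ℕ.<? v
  ... | 1≤a , _   | yes a<v rewrite punchOut-< a<v = ∈-range1⁺ 1≤a (ℕP.≤-pred (ℕP.≤-trans a<v v≤))
  ... | _   , a≤  | no  a≮v with ℕP.≤∧≢⇒< (ℕP.≮⇒≥ a≮v) (a≢v ∘ sym)
  ...   | v<a rewrite punchOut-≥ (ℕP.≮⇒≥ a≮v) with a | v<a
  ...     | suc a′ | s≤s v≤a′ = ∈-range1⁺ (ℕP.≤-trans 1≤v v≤a′) (ℕP.≤-pred a≤)

  punchIn-range : ∀ {n} v {b} → b ∈ range1 n → punchIn v b ∈ range1 (suc n)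
  punchIn-range v {b} b∈ with ∈-range1⁻ b∈ | b ℕ.<? v
  ... | 1≤b , b≤n | yes b<v rewrite punchIn-< b<v = ∈-range1⁺ 1≤b (ℕP.m≤n⇒m≤1+n b≤n)
  ... | _   , b≤n | no  b≮v rewrite punchIn-≥ (ℕP.≮⇒≥ b≮v) = ∈-range1⁺ (s≤s z≤n) (s≤s b≤n)

  length-insertLast : ∀ v π → length (insertLast v π) ≡ suc (length π)
  length-insertLast v π = begin
    length (map (punchIn v) π ++ v ∷ [])   ≡⟨ LP.length-++ (map (punchIn v) π) ⟩
    length (map (punchIn v) π) + 1         ≡⟨ ℕP.+-comm _ 1 ⟩
    suc (length (map (punchIn v) π))       ≡⟨ cong suc (LP.length-map (punchIn v) π) ⟩
    suc (length π)                         ∎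
    where open ≡-Reasoning

  insertLast-perm : ∀ {n π v} → IsPerm n π → 1 ≤ v → v ≤ suc n → IsPerm (suc n) (insertLast v π)
  insertLast-perm {n} {π} {v} p 1≤v v≤ = record
    { length≡ = trans (length-insertLast v π) (cong suc (length≡ p))
    ; values  = vals
    ; covers  = cov
    }
    where
    vals : insertLast v π ⊆ range1 (suc n)
    vals a∈ with ∈-++⁻ (map (punchIn v) π) a∈
    ... | inj₂ (here refl) = ∈-range1⁺ 1≤v v≤
    ... | inj₁ a∈′ with ∈-map⁻ (punchIn v) a∈′
    ...   | b , b∈ , refl = punchIn-range v (values p b∈)
    cov : range1 (suc n) ⊆ insertLast v π
    cov {t} t∈ with t ℕ.≟ v
    ... | yes refl = ∈-++⁺ʳ (map (punchIn v) π) (here refl)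
    ... | no  t≢v  = ∈-++⁺ˡ (subst (_∈ map (punchIn v) π) (punchIn-punchOut v t t≢v)
                      (∈-map⁺ (punchIn v) (covers p (punchOut-range 1≤v v≤ t∈ t≢v))))

  removeLast : ∀ {n τ} → IsPerm (suc n) τ →
    ∃₂ λ v π → τ ≡ insertLast v π × IsPerm n π × 1 ≤ v × v ≤ suc n
  removeLast {n} {τ} p with snoc-view τ (length≡ p)
  ... | ys , v , refl = v , π , τ≡ , record { length≡ = lenπ ; values = valsπ ; covers = covπ } , v-range
    where
    v-range = ∈-range1⁻ (values p (∈-++⁺ʳ ys (here refl)))
    v∉ys : v ∉ ys
    v∉ys v∈ys = proj₂ (unique-drop-mid ys [] (unique p)) (∈-++⁺ˡ v∈ys)
    π = map (punchOut v) ys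
    τ≡ : ys ++ v ∷ [] ≡ insertLast v π
    τ≡ = cong (_++ v ∷ []) (trans (sym (LP.map-id ys))
           (trans (map-cong-∈ ys (λ x∈ → sym (punchIn-punchOut v _ (λ { refl → v∉ys x∈ })))) (LP.map-∘ ys)))
    lenπ : length π ≡ n
    lenπ = trans (LP.length-map (punchOut v) ys)
                 (ℕP.suc-injective (trans (ℕP.+-comm 1 (length ys)) (trans (sym (LP.length-++ ys)) (length≡ p))))
    valsπ : π ⊆ range1 n
    valsπ a∈ with ∈-map⁻ (punchOut v) a∈
    ... | b , b∈ , refl =
      punchOut-range (proj₁ v-range) (proj₂ v-range) (values p (∈-++⁺ˡ b∈)) (λ { refl → v∉ys b∈ })
    covπ : range1 n ⊆ π
    covπ {t} t∈ with ∈-++⁻ ys (covers p (punchIn-range v t∈))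
    ... | inj₁ b∈        = subst (_∈ π) (punchOut-punchIn v t) (∈-map⁺ (punchOut v) b∈)
    ... | inj₂ (here eq) = ⊥-elim (punchIn≢ v t eq)

  insertLast-injective : ∀ {v v′ π π′} → insertLast v π ≡ insertLast v′ π′ → v ≡ v′ × π ≡ π′
  insertLast-injective {v} {v′} {π} {π′} eq with LP.∷ʳ-injective (map (punchIn v) π) (map (punchIn v′) π′) eq
  ... | mapπ≡ , refl = refl , LP.map-injective (punchIn-injective v) mapπ≡

module Occurrences where

  open import Data.Nat using (_+_)
  open import Data.Nat.Tactic.RingSolver using (solve-∀)
  open Counting
  open Booleans
  open ListFacts
  open Permutations
  open Insertion

  private
    splitFirst : ∀ a u b s → Σ Bool λ r → sameOrder (a ∷ u) (b ∷ s) ≡ r ∧ sameOrder u s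
    splitFirst a u b s = _ , refl

  -- sameOrder compares the first entries with the rest by a function local to its where block;
  -- this names it, so that sameOrder (a ∷ u) (b ∷ s) ≡ firstRow a u b s ∧ sameOrder u s holds by refl.
  firstRow : ℕ → List ℕ → ℕ → List ℕ → Bool
  firstRow a u b s = proj₁ (splitFirst a u b s)

  module _ (f : ℕ → ℕ) (f-<ᵇ : ∀ a c → (f a <ᵇ f c) ≡ (a <ᵇ c)) where

    firstRow-map : ∀ t τ a u → firstRow t τ (f a) (map f u) ≡ firstRow t τ a u
    firstRow-map t []      a []      = refl
    firstRow-map t []      a (c ∷ u) = refl
    firstRow-map t (x ∷ τ) a []      = refl
    firstRow-map t (x ∷ τ) a (c ∷ u) rewrite f-<ᵇ a c | f-<ᵇ c a =
      cong (sameCmp t x a c ∧_) (firstRow-map t τ a u)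

    sameOrder-map : ∀ σ u → sameOrder σ (map f u) ≡ sameOrder σ u
    sameOrder-map []      []      = refl
    sameOrder-map []      (c ∷ u) = refl
    sameOrder-map (x ∷ σ) []      = refl
    sameOrder-map (x ∷ σ) (a ∷ u) = cong₂ _∧_ (firstRow-map x σ a u) (sameOrder-map σ u)

    subseqs-map : ∀ j xs → subseqs j (map f xs) ≡ map (map f) (subseqs j xs)
    subseqs-map zero    xs       = refl
    subseqs-map (suc j) []       = refl
    subseqs-map (suc j) (a ∷ xs) = begin
      map (f a ∷_) (subseqs j (map f xs)) ++ subseqs (suc j) (map f xs)
        ≡⟨ cong₂ (λ ys zs → map (f a ∷_) ys ++ zs) (subseqs-map j xs) (subseqs-map (suc j) xs) ⟩
      map (f a ∷_) (map (map f) (subseqs j xs)) ++ map (map f) (subseqs (suc j) xs)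
        ≡⟨ cong (_++ _) (trans (sym (LP.map-∘ (subseqs j xs))) (LP.map-∘ (subseqs j xs))) ⟩
      map (map f) (map (a ∷_) (subseqs j xs)) ++ map (map f) (subseqs (suc j) xs)
        ≡⟨ LP.map-++ (map f) (map (a ∷_) (subseqs j xs)) _ ⟨
      map (map f) (subseqs (suc j) (a ∷ xs)) ∎
      where open ≡-Reasoning

    occ-map : ∀ σ xs → occ σ (map f xs) ≡ occ σ xs
    occ-map σ xs = begin
      countᵇ (sameOrder σ) (subseqs (length σ) (map f xs))
        ≡⟨ cong (countᵇ (sameOrder σ)) (subseqs-map (length σ) xs) ⟩
      countᵇ (sameOrder σ) (map (map f) (subseqs (length σ) xs))
        ≡⟨ countᵇ-map (sameOrder σ) (map f) (subseqs (length σ) xs) ⟩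
      countᵇ (sameOrder σ ∘ map f) (subseqs (length σ) xs)
        ≡⟨ countᵇ-cong _ _ (subseqs (length σ) xs) (λ {u} _ → sameOrder-map σ u) ⟩
      countᵇ (sameOrder σ) (subseqs (length σ) xs) ∎
      where open ≡-Reasoning

  countᵇ-subseqs-snoc : ∀ (p : List ℕ → Bool) j xs v →
    countᵇ p (subseqs (suc j) (xs ++ v ∷ [])) ≡
      countᵇ p (subseqs (suc j) xs) + countᵇ (λ u → p (u ++ v ∷ [])) (subseqs j xs)
  countᵇ-subseqs-snoc p zero    []       v =
    trans (countᵇ-∷ p (v ∷ []) []) (sym (countᵇ-∷ (λ u → p (u ++ v ∷ [])) [] []))
  countᵇ-subseqs-snoc p (suc j) []       v = countᵇ-++ p (map (v ∷_) (subseqs (suc j) [])) []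
  countᵇ-subseqs-snoc p zero    (a ∷ xs) v
    rewrite countᵇ-++ p (map (a ∷_) (subseqs zero (xs ++ v ∷ []))) (subseqs 1 (xs ++ v ∷ []))
          | countᵇ-++ p (map (a ∷_) (subseqs zero xs)) (subseqs 1 xs)
          | countᵇ-subseqs-snoc p zero xs v
    = sym (ℕP.+-assoc (countᵇ p (map (a ∷_) (subseqs zero xs))) (countᵇ p (subseqs 1 xs)) _)
  countᵇ-subseqs-snoc p (suc j) (a ∷ xs) v
    rewrite countᵇ-++ p (map (a ∷_) (subseqs (suc j) (xs ++ v ∷ []))) (subseqs (suc (suc j)) (xs ++ v ∷ []))
          | countᵇ-++ p (map (a ∷_) (subseqs (suc j) xs)) (subseqs (suc (suc j)) xs)
          | countᵇ-++ (λ u → p (u ++ v ∷ [])) (map (a ∷_) (subseqs j xs)) (subseqs (suc j) xs)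
          | countᵇ-map p (a ∷_) (subseqs (suc j) (xs ++ v ∷ []))
          | countᵇ-map p (a ∷_) (subseqs (suc j) xs)
          | countᵇ-map (λ u → p (u ++ v ∷ [])) (a ∷_) (subseqs j xs)
          | countᵇ-subseqs-snoc (p ∘ (a ∷_)) j xs v
          | countᵇ-subseqs-snoc p (suc j) xs v
    = interchange (countᵇ (p ∘ (a ∷_)) (subseqs (suc j) xs))
                  (countᵇ (λ u → p (a ∷ u ++ v ∷ [])) (subseqs j xs))
                  (countᵇ p (subseqs (suc (suc j)) xs))
                  (countᵇ (λ u → p (u ++ v ∷ [])) (subseqs (suc j) xs))
    where
    interchange : ∀ a b c d → a + b + (c + d) ≡ a + c + (b + d)
    interchange = solve-∀

  lastColumn : List ℕ → ℕ → List ℕ → ℕ → Bool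
  lastColumn []      s []      v = true
  lastColumn (t ∷ τ) s (a ∷ u) v = sameCmp t s a v ∧ lastColumn τ s u v
  lastColumn _       _ _       _ = false

  firstRow-snoc : ∀ t τ s a u v →
                  firstRow t (τ ++ s ∷ []) a (u ++ v ∷ []) ≡ firstRow t τ a u ∧ sameCmp t s a v
  firstRow-snoc t []      s a []      v = BP.∧-identityʳ (sameCmp t s a v)
  firstRow-snoc t []      s a (c ∷ u) v = trans (cong (sameCmp t s a c ∧_) (tooShort u)) (BP.∧-zeroʳ _)
    where
    tooShort : ∀ u → firstRow t [] a (u ++ v ∷ []) ≡ false
    tooShort []      = refl
    tooShort (_ ∷ _) = refl
  firstRow-snoc t (x ∷ τ) s a []      v = trans (cong (sameCmp t x a v ∧_) (tooLong τ)) (BP.∧-zeroʳ _)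
    where
    tooLong : ∀ τ → firstRow t (τ ++ s ∷ []) a [] ≡ false
    tooLong []      = refl
    tooLong (_ ∷ _) = refl
  firstRow-snoc t (x ∷ τ) s a (c ∷ u) v = trans (cong (sameCmp t x a c ∧_) (firstRow-snoc t τ s a u v))
    (sym (BP.∧-assoc (sameCmp t x a c) (firstRow t τ a u) (sameCmp t s a v)))

  sameOrder-snoc : ∀ τ s u v → length τ ≡ length u →
    sameOrder (τ ++ s ∷ []) (u ++ v ∷ []) ≡ sameOrder τ u ∧ lastColumn τ s u v
  sameOrder-snoc []      s []      v _   = refl
  sameOrder-snoc (x ∷ τ) s (c ∷ u) v len = trans
    (cong₂ _∧_ (firstRow-snoc x τ s c u v) (sameOrder-snoc τ s u v (ℕP.suc-injective len)))
    (∧-interchange (firstRow x τ c u) (sameCmp x s c v) (sameOrder τ u) (lastColumn τ s u v))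

  length-subseqs : ∀ {j xs u} → u ∈ subseqs j xs → length u ≡ j
  length-subseqs {zero}              (here refl) = refl
  length-subseqs {suc j} {x ∷ xs} u∈ with ∈-++⁻ (map (x ∷_) (subseqs j xs)) u∈
  ... | inj₂ u∈′ = length-subseqs {suc j} {xs} u∈′
  ... | inj₁ u∈′ with ∈-map⁻ (x ∷_) u∈′
  ...   | w , w∈ , refl = cong suc (length-subseqs {j} {xs} w∈)

  occ-snoc : ∀ τ s xs v → occ (τ ++ s ∷ []) (xs ++ v ∷ []) ≡
    occ (τ ++ s ∷ []) xs + countᵇ (λ u → sameOrder τ u ∧ lastColumn τ s u v) (subseqs (length τ) xs)
  occ-snoc τ s xs v rewrite LP.length-++ τ {s ∷ []} | ℕP.+-comm (length τ) 1 =
    trans (countᵇ-subseqs-snoc (sameOrder (τ ++ s ∷ [])) (length τ) xs v)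
      (cong (countᵇ (sameOrder (τ ++ s ∷ [])) (subseqs (suc (length τ)) xs) +_)
        (countᵇ-cong _ _ (subseqs (length τ) xs)
          (λ {u} u∈ → sameOrder-snoc τ s u v (sym (length-subseqs {length τ} {xs} u∈)))))

  sameCmp-< : ∀ {t s} → (t <ᵇ s) ≡ true → ∀ a b → sameCmp t s a b ≡ (a <ᵇ b)
  sameCmp-< {t} {s} t<s a b rewrite t<s | <ᵇ-asym {t} {s} t<s with a <ᵇ b in a<b
  ... | true  rewrite <ᵇ-asym {a} {b} a<b = refl
  ... | false = refl

  lastColumn-max : ∀ τ s u v → all (_<ᵇ s) τ ≡ true → length τ ≡ length u →
                   lastColumn τ s u v ≡ all (_<ᵇ v) u
  lastColumn-max []      s []      v _    _   = refl
  lastColumn-max (t ∷ τ) s (a ∷ u) v τ<s len with ∧-true⁻ {t <ᵇ s} τ<s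
  ... | t<s , τ′<s = cong₂ _∧_ (sameCmp-< {t} {s} t<s a v) (lastColumn-max τ s u v τ′<s (ℕP.suc-injective len))

  countᵇ-subseqs-below : ∀ v (q : List ℕ → Bool) j xs →
    countᵇ (λ u → all (_<ᵇ v) u ∧ q u) (subseqs j xs) ≡ countᵇ q (subseqs j (filterᵇ (_<ᵇ v) xs))
  countᵇ-subseqs-below v q zero    xs =
    trans (countᵇ-∷ (λ u → all (_<ᵇ v) u ∧ q u) [] []) (sym (countᵇ-∷ q [] []))
  countᵇ-subseqs-below v q (suc j) []       = refl
  countᵇ-subseqs-below v q (suc j) (a ∷ xs)
    rewrite filterᵇ-∷ (_<ᵇ v) a xs
          | countᵇ-++ (λ u → all (_<ᵇ v) u ∧ q u) (map (a ∷_) (subseqs j xs)) (subseqs (suc j) xs)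
          | countᵇ-map (λ u → all (_<ᵇ v) u ∧ q u) (a ∷_) (subseqs j xs)
    with a <ᵇ v
  ... | true
    rewrite countᵇ-++ q (map (a ∷_) (subseqs j (filterᵇ (_<ᵇ v) xs))) (subseqs (suc j) (filterᵇ (_<ᵇ v) xs))
          | countᵇ-map q (a ∷_) (subseqs j (filterᵇ (_<ᵇ v) xs))
    = cong₂ _+_ (countᵇ-subseqs-below v (q ∘ (a ∷_)) j xs) (countᵇ-subseqs-below v q (suc j) xs)
  ... | false = cong₂ _+_ (countᵇ-none _ (subseqs j xs) (λ _ → refl)) (countᵇ-subseqs-below v q (suc j) xs)

  filterᵇ-punchIn : ∀ v π → filterᵇ (_<ᵇ v) (map (punchIn v) π) ≡ filterᵇ (_<ᵇ v) π
  filterᵇ-punchIn v []      = refl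
  filterᵇ-punchIn v (a ∷ π)
    rewrite filterᵇ-∷ (_<ᵇ v) (punchIn v a) (map (punchIn v) π) | filterᵇ-∷ (_<ᵇ v) a π
    with a ℕ.<? v
  ... | yes a<v rewrite punchIn-< a<v | <ᵇ-true a<v = cong (a ∷_) (filterᵇ-punchIn v π)
  ... | no  a≮v rewrite punchIn-≥ (ℕP.≮⇒≥ a≮v) | <ᵇ-false (ℕP.≮⇒≥ a≮v)
                      | <ᵇ-false (ℕP.m≤n⇒m≤1+n (ℕP.≮⇒≥ a≮v)) = filterᵇ-punchIn v π

  -- New occurrences of a pattern ending in its maximum use the new last entry v,
  -- hence only entries below v: they are the occurrences of the rest of the pattern there.
  occ-insertLast : ∀ τ s v π → all (_<ᵇ s) τ ≡ true →
    occ (τ ++ s ∷ []) (insertLast v π) ≡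
      occ (τ ++ s ∷ []) π + countᵇ (sameOrder τ) (subseqs (length τ) (filterᵇ (_<ᵇ v) π))
  occ-insertLast τ s v π τ<s = begin
    occ σ (map (punchIn v) π ++ v ∷ [])
      ≡⟨ occ-snoc τ s (map (punchIn v) π) v ⟩
    occ σ (map (punchIn v) π) + countᵇ (λ u → sameOrder τ u ∧ lastColumn τ s u v) (subseqs L (map (punchIn v) π))
      ≡⟨ cong₂ _+_ (occ-map (punchIn v) (punchIn-<ᵇ v) σ π)
           (countᵇ-cong _ _ (subseqs L (map (punchIn v) π)) lastColumn-below) ⟩
    occ σ π + countᵇ (λ u → all (_<ᵇ v) u ∧ sameOrder τ u) (subseqs L (map (punchIn v) π))
      ≡⟨ cong (occ σ π +_) (countᵇ-subseqs-below v (sameOrder τ) L (map (punchIn v) π)) ⟩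
    occ σ π + countᵇ (sameOrder τ) (subseqs L (filterᵇ (_<ᵇ v) (map (punchIn v) π)))
      ≡⟨ cong (λ ys → occ σ π + countᵇ (sameOrder τ) (subseqs L ys)) (filterᵇ-punchIn v π) ⟩
    occ σ π + countᵇ (sameOrder τ) (subseqs L (filterᵇ (_<ᵇ v) π)) ∎
    where
    open ≡-Reasoning
    σ = τ ++ s ∷ []
    L = length τ
    lastColumn-below : ∀ {u} → u ∈ subseqs L (map (punchIn v) π) →
      (sameOrder τ u ∧ lastColumn τ s u v) ≡ (all (_<ᵇ v) u ∧ sameOrder τ u)
    lastColumn-below {u} u∈ =
      trans (cong (sameOrder τ u ∧_) (lastColumn-max τ s u v τ<s (sym (length-subseqs {L} {map (punchIn v) π} u∈))))
            (BP.∧-comm (sameOrder τ u) (all (_<ᵇ v) u))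

  countᵇ≡0⇒all : {A : Set} (p : A → Bool) → ∀ xs → countᵇ p xs ≡ 0 → all (not ∘ p) xs ≡ true
  countᵇ≡0⇒all p []       _ = refl
  countᵇ≡0⇒all p (x ∷ xs) e rewrite countᵇ-∷ p x xs with p x
  ... | false = countᵇ≡0⇒all p xs e

  all⇒countᵇ≡0 : {A : Set} (p : A → Bool) → ∀ xs → all (not ∘ p) xs ≡ true → countᵇ p xs ≡ 0
  all⇒countᵇ≡0 p []       _ = refl
  all⇒countᵇ≡0 p (x ∷ xs) e rewrite countᵇ-∷ p x xs with p x
  ... | false = all⇒countᵇ≡0 p xs e

  pat12 : List ℕ
  pat12 = 1 ∷ 2 ∷ []

  nonIncreasing : List ℕ → Bool
  nonIncreasing []       = true
  nonIncreasing (a ∷ ys) = all (λ b → not (a <ᵇ b)) ys ∧ nonIncreasing ys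

  decreasing : List ℕ → Bool
  decreasing []       = true
  decreasing (a ∷ ys) = all (_<ᵇ a) ys ∧ decreasing ys

  sameOrder-12 : ∀ a b → sameOrder pat12 (a ∷ b ∷ []) ≡ (a <ᵇ b)
  sameOrder-12 a b with a <ᵇ b in a<b
  ... | true  rewrite <ᵇ-asym {a} {b} a<b = refl
  ... | false = refl

  occ12-∷ : ∀ y ys → occ pat12 (y ∷ ys) ≡ countᵇ (y <ᵇ_) ys + occ pat12 ys
  occ12-∷ y ys = begin
    countᵇ (sameOrder pat12) (map (y ∷_) (subseqs 1 ys) ++ subseqs 2 ys)
      ≡⟨ countᵇ-++ (sameOrder pat12) (map (y ∷_) (subseqs 1 ys)) _ ⟩
    countᵇ (sameOrder pat12) (map (y ∷_) (subseqs 1 ys)) + occ pat12 ys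
      ≡⟨ cong (_+ occ pat12 ys) (countᵇ-map (sameOrder pat12) (y ∷_) (subseqs 1 ys)) ⟩
    countᵇ (sameOrder pat12 ∘ (y ∷_)) (subseqs 1 ys) + occ pat12 ys
      ≡⟨ cong (_+ occ pat12 ys) (pairsWithHead ys) ⟩
    countᵇ (y <ᵇ_) ys + occ pat12 ys ∎
    where
    open ≡-Reasoning
    pairsWithHead : ∀ ys → countᵇ (sameOrder pat12 ∘ (y ∷_)) (subseqs 1 ys) ≡ countᵇ (y <ᵇ_) ys
    pairsWithHead []       = refl
    pairsWithHead (b ∷ ys) rewrite countᵇ-∷ (sameOrder pat12 ∘ (y ∷_)) (b ∷ []) (subseqs 1 ys)
                                 | countᵇ-∷ (y <ᵇ_) b ys | sameOrder-12 y b
      = cong ((if y <ᵇ b then 1 else 0) +_) (pairsWithHead ys)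

  occ12≡0⇒nonIncreasing : ∀ ys → occ pat12 ys ≡ 0 → nonIncreasing ys ≡ true
  occ12≡0⇒nonIncreasing []       _ = refl
  occ12≡0⇒nonIncreasing (y ∷ ys) e rewrite occ12-∷ y ys
    = cong₂ _∧_ (countᵇ≡0⇒all (y <ᵇ_) ys (ℕP.m+n≡0⇒m≡0 _ e))
                (occ12≡0⇒nonIncreasing ys (ℕP.m+n≡0⇒n≡0 _ e))

  nonIncreasing⇒occ12≡0 : ∀ ys → nonIncreasing ys ≡ true → occ pat12 ys ≡ 0
  nonIncreasing⇒occ12≡0 []       _ = refl
  nonIncreasing⇒occ12≡0 (y ∷ ys) e with ∧-true⁻ {all (λ b → not (y <ᵇ b)) ys} e
  ... | head-max , rest rewrite occ12-∷ y ys
    = cong₂ _+_ (all⇒countᵇ≡0 (y <ᵇ_) ys head-max) (nonIncreasing⇒occ12≡0 ys rest)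

  nonIncreasing⇒decreasing : ∀ {ys} → Unique ys → nonIncreasing ys ≡ true → decreasing ys ≡ true
  nonIncreasing⇒decreasing {[]}     _          _ = refl
  nonIncreasing⇒decreasing {y ∷ ys} (y∉ ∷ u) e with ∧-true⁻ {all (λ b → not (y <ᵇ b)) ys} e
  ... | head-max , rest = cong₂ _∧_
    (all⁺ (_<ᵇ y) (λ {b} b∈ → below b (all⁻ (λ b → not (y <ᵇ b)) head-max b∈) (All.lookup y∉ b∈)))
    (nonIncreasing⇒decreasing u rest)
    where
    below : ∀ b → not (y <ᵇ b) ≡ true → y ≢ b → (b <ᵇ y) ≡ true
    below b y≮b y≢b with y <ᵇ b in y<b
    ... | false = <ᵇ-true (ℕP.≤∧≢⇒< (<ᵇ-false⁻ y<b) (y≢b ∘ sym))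

  subseqs-⊆ : ∀ {j xs u} → u ∈ subseqs j xs → u ⊆ xs
  subseqs-⊆ {zero}              (here refl) ()
  subseqs-⊆ {suc j} {x ∷ xs} u∈ with ∈-++⁻ (map (x ∷_) (subseqs j xs)) u∈
  ... | inj₂ u∈′ = there ∘ subseqs-⊆ {suc j} {xs} u∈′
  ... | inj₁ u∈′ with ∈-map⁻ (x ∷_) u∈′
  ...   | w , w∈ , refl = λ { (here refl) → here refl ; (there a∈) → there (subseqs-⊆ {j} {xs} w∈ a∈) }

  decreasing-subseqs : ∀ {j xs u} → decreasing xs ≡ true → u ∈ subseqs j xs → decreasing u ≡ true
  decreasing-subseqs {zero}              _ (here refl) = refl
  decreasing-subseqs {suc j} {x ∷ xs} e u∈
    with ∧-true⁻ {all (_<ᵇ x) xs} e | ∈-++⁻ (map (x ∷_) (subseqs j xs)) u∈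
  ... | _      , rest | inj₂ u∈′ = decreasing-subseqs {suc j} {xs} rest u∈′
  ... | x-max , rest | inj₁ u∈′ with ∈-map⁻ (x ∷_) u∈′
  ...   | w , w∈ , refl = cong₂ _∧_ (all⁺ (_<ᵇ x) (λ a∈ → all⁻ (_<ᵇ x) x-max (subseqs-⊆ {j} {xs} w∈ a∈)))
                                    (decreasing-subseqs {j} {xs} rest w∈)

  sameOrder-decreasing : ∀ τ u → decreasing τ ≡ true → decreasing u ≡ true → length τ ≡ length u →
                         sameOrder τ u ≡ true
  sameOrder-decreasing []      []      _   _   _   = refl
  sameOrder-decreasing (t ∷ τ) (a ∷ u) dτ du len
    with ∧-true⁻ {all (_<ᵇ t) τ} dτ | ∧-true⁻ {all (_<ᵇ a) u} du
  ... | τ<t , dτ′ | u<a , du′ =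
    cong₂ _∧_ (firstRow-decreasing τ u τ<t u<a (ℕP.suc-injective len))
              (sameOrder-decreasing τ u dτ′ du′ (ℕP.suc-injective len))
    where
    firstRow-decreasing : ∀ τ u → all (_<ᵇ t) τ ≡ true → all (_<ᵇ a) u ≡ true → length τ ≡ length u →
                          firstRow t τ a u ≡ true
    firstRow-decreasing []      []      _ _ _ = refl
    firstRow-decreasing (x ∷ τ) (y ∷ u) τ<t u<a len with ∧-true⁻ {x <ᵇ t} τ<t | ∧-true⁻ {y <ᵇ a} u<a
    ... | x<t , τ′<t | y<a , u′<a rewrite x<t | y<a | <ᵇ-asym {x} {t} x<t | <ᵇ-asym {y} {a} y<a
      = firstRow-decreasing τ u τ′<t u′<a (ℕP.suc-injective len)

  length-subseqs-C : ∀ j xs → length (subseqs j xs) ≡ length xs C j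
  length-subseqs-C zero    xs       = refl
  length-subseqs-C (suc j) []       = refl
  length-subseqs-C (suc j) (x ∷ xs) = begin
    length (map (x ∷_) (subseqs j xs) ++ subseqs (suc j) xs)
      ≡⟨ LP.length-++ (map (x ∷_) (subseqs j xs)) ⟩
    length (map (x ∷_) (subseqs j xs)) + length (subseqs (suc j) xs)
      ≡⟨ cong₂ _+_ (trans (LP.length-map (x ∷_) (subseqs j xs)) (length-subseqs-C j xs))
                   (length-subseqs-C (suc j) xs) ⟩
    length xs C j + length xs C suc j
      ≡⟨ nCk+nC[k+1]≡[n+1]C[k+1] (length xs) j ⟩
    suc (length xs) C suc j ∎
    where open ≡-Reasoning

  -- (k - 1)(k - 2) … 1 for k = suc j
  descent : ℕ → List ℕ
  descent j = map suc (downFrom j)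

  length-descent : ∀ j → length (descent j) ≡ j
  length-descent j = trans (LP.length-map suc (downFrom j)) (LP.length-downFrom j)

  descent-below : ∀ j → all (_<ᵇ suc j) (descent j) ≡ true
  descent-below j = all⁺ (_<ᵇ suc j) below
    where
    below : ∀ {x} → x ∈ descent j → (x <ᵇ suc j) ≡ true
    below x∈ with ∈-map⁻ suc x∈
    ... | i , i∈ , refl = <ᵇ-true (s≤s (∈-downFrom⁻ i∈))

  descent-decreasing : ∀ j → decreasing (descent j) ≡ true
  descent-decreasing zero    = refl
  descent-decreasing (suc j) = cong₂ _∧_ (descent-below j) (descent-decreasing j)

  length-below : ∀ {n π p} → IsPerm n π → p ≤ n → length (filterᵇ (_<ᵇ suc p) π) ≡ p
  length-below {n} {π} {p} isP p≤n = trans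
    (↭.↭-length (↭-fromMembers (Unique.filter⁺ (T? ∘ (_<ᵇ suc p)) (unique isP)) (unique-range1 p)
                               below⊆ ⊆below))
    (length-range1 p)
    where
    below⊆ : filterᵇ (_<ᵇ suc p) π ⊆ range1 p
    below⊆ a∈ with ∈-filterᵇ⁻ (_<ᵇ suc p) a∈
    ... | a∈π , a<  = ∈-range1⁺ (proj₁ (∈-range1⁻ (values isP a∈π))) (ℕP.≤-pred (<ᵇ-true⁻ a<))
    ⊆below : range1 p ⊆ filterᵇ (_<ᵇ suc p) π
    ⊆below t∈ with ∈-range1⁻ t∈
    ... | 1≤t , t≤p =
      ∈-filterᵇ⁺ (_<ᵇ suc p) (covers isP (∈-range1⁺ 1≤t (ℕP.≤-trans t≤p p≤n))) (<ᵇ-true (s≤s t≤p))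

  occ123-insertLast : ∀ v π → occ pat123 (insertLast v π) ≡ occ pat123 π + occ pat12 (filterᵇ (_<ᵇ v) π)
  occ123-insertLast v π = occ-insertLast pat12 3 v π refl

  -- Every subsequence of length k - 1 of the values below the new last entry completes an occurrence
  -- of (k-1)…1k: these values avoid 12 and are distinct, hence decreasing.
  occK-insertLast : ∀ j {n π p} → IsPerm n π → p ≤ n → nonIncreasing (filterᵇ (_<ᵇ suc p) π) ≡ true →
    occ (patK (suc j)) (insertLast (suc p) π) ≡ occ (patK (suc j)) π + p C j
  occK-insertLast j {n} {π} {p} isP p≤n ys-nonIncreasing = begin
    occ σ (insertLast (suc p) π)
      ≡⟨ occ-insertLast (descent j) (suc j) (suc p) π (descent-below j) ⟩
    occ σ π + countᵇ (sameOrder (descent j)) (subseqs L ys)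
      ≡⟨ cong (occ σ π +_) (countᵇ-all _ (subseqs L ys) allOccur) ⟩
    occ σ π + length (subseqs L ys)
      ≡⟨ cong (occ σ π +_)
           (trans (length-subseqs-C L ys) (cong₂ _C_ (length-below isP p≤n) (length-descent j))) ⟩
    occ σ π + p C j ∎
    where
    open ≡-Reasoning
    σ = patK (suc j)
    L = length (descent j)
    ys = filterᵇ (_<ᵇ suc p) π
    ys-decreasing : decreasing ys ≡ true
    ys-decreasing = nonIncreasing⇒decreasing (Unique.filter⁺ (T? ∘ (_<ᵇ suc p)) (unique isP)) ys-nonIncreasing
    allOccur : ∀ {u} → u ∈ subseqs L ys → sameOrder (descent j) u ≡ true
    allOccur {u} u∈ = sameOrder-decreasing (descent j) u (descent-decreasing j)
      (decreasing-subseqs {L} {ys} ys-decreasing u∈) (sym (length-subseqs {L} {ys} u∈))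

module State where

  open Booleans
  open ListFacts
  open Permutations
  open Insertion
  open Occurrences using (nonIncreasing)

  lowDecreasing : List ℕ → ℕ → Bool
  lowDecreasing π v = nonIncreasing (filterᵇ (_<ᵇ v) π)

  stateUpTo : List ℕ → ℕ → ℕ
  stateUpTo π zero    = 0
  stateUpTo π (suc t) = if lowDecreasing π (suc (suc t)) then suc t else stateUpTo π t

  -- the largest p such that 1, …, p appear in π in decreasing order
  state : List ℕ → ℕ
  state π = stateUpTo π (length π)

  all-filterᵇ : ∀ (q p : ℕ → Bool) ys → all q ys ≡ true → all q (filterᵇ p ys) ≡ true
  all-filterᵇ q p []       _ = refl
  all-filterᵇ q p (y ∷ ys) e with ∧-true⁻ {q y} e
  ... | qy , rest rewrite filterᵇ-∷ p y ys with p y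
  ...   | true  = cong₂ _∧_ qy (all-filterᵇ q p ys rest)
  ...   | false = all-filterᵇ q p ys rest

  nonIncreasing-filterᵇ : ∀ (p : ℕ → Bool) ys →
                          nonIncreasing ys ≡ true → nonIncreasing (filterᵇ p ys) ≡ true
  nonIncreasing-filterᵇ p []       _ = refl
  nonIncreasing-filterᵇ p (y ∷ ys) e with ∧-true⁻ {all (λ b → not (y <ᵇ b)) ys} e
  ... | head-max , rest rewrite filterᵇ-∷ p y ys with p y
  ...   | true  = cong₂ _∧_ (all-filterᵇ _ p ys head-max) (nonIncreasing-filterᵇ p ys rest)
  ...   | false = nonIncreasing-filterᵇ p ys rest

  filterᵇ-<ᵇ-filterᵇ : ∀ u v π → u ≤ v → filterᵇ (_<ᵇ u) (filterᵇ (_<ᵇ v) π) ≡ filterᵇ (_<ᵇ u) π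
  filterᵇ-<ᵇ-filterᵇ u v []      _   = refl
  filterᵇ-<ᵇ-filterᵇ u v (a ∷ π) u≤v rewrite filterᵇ-∷ (_<ᵇ v) a π with a ℕ.<? u
  ... | yes a<u rewrite <ᵇ-true (ℕP.<-≤-trans a<u u≤v) | filterᵇ-∷ (_<ᵇ u) a (filterᵇ (_<ᵇ v) π)
                      | filterᵇ-∷ (_<ᵇ u) a π | <ᵇ-true a<u = cong (a ∷_) (filterᵇ-<ᵇ-filterᵇ u v π u≤v)
  ... | no  a≮u with a <ᵇ v
  ...   | true  rewrite filterᵇ-∷ (_<ᵇ u) a (filterᵇ (_<ᵇ v) π) | filterᵇ-∷ (_<ᵇ u) a π
                      | <ᵇ-false (ℕP.≮⇒≥ a≮u) = filterᵇ-<ᵇ-filterᵇ u v π u≤v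
  ...   | false rewrite filterᵇ-∷ (_<ᵇ u) a π | <ᵇ-false (ℕP.≮⇒≥ a≮u) = filterᵇ-<ᵇ-filterᵇ u v π u≤v

  lowDecreasing-mono : ∀ π {u v} → u ≤ v → lowDecreasing π v ≡ true → lowDecreasing π u ≡ true
  lowDecreasing-mono π {u} {v} u≤v e = subst (λ ys → nonIncreasing ys ≡ true)
    (filterᵇ-<ᵇ-filterᵇ u v π u≤v) (nonIncreasing-filterᵇ (_<ᵇ u) (filterᵇ (_<ᵇ v) π) e)

  lowDecreasing-1 : ∀ {n π} → IsPerm n π → lowDecreasing π 1 ≡ true
  lowDecreasing-1 {n} {π} isP = subst (λ ys → nonIncreasing ys ≡ true) (sym (nothingBelow1 π (values isP))) refl
    where
    nothingBelow1 : ∀ xs → xs ⊆ range1 n → filterᵇ (_<ᵇ 1) xs ≡ []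
    nothingBelow1 []       _   = refl
    nothingBelow1 (a ∷ xs) xs⊆
      rewrite filterᵇ-∷ (_<ᵇ 1) a xs | <ᵇ-false (proj₁ (∈-range1⁻ (xs⊆ (here refl))))
      = nothingBelow1 xs (xs⊆ ∘ there)

  stateUpTo-lowDecreasing : ∀ π → lowDecreasing π 1 ≡ true → ∀ T →
                            lowDecreasing π (suc (stateUpTo π T)) ≡ true
  stateUpTo-lowDecreasing π ld1 zero    = ld1
  stateUpTo-lowDecreasing π ld1 (suc t) with lowDecreasing π (suc (suc t)) in ld
  ... | true  = ld
  ... | false = stateUpTo-lowDecreasing π ld1 t

  stateUpTo-max : ∀ π T p → p ≤ T → lowDecreasing π (suc p) ≡ true → p ≤ stateUpTo π T
  stateUpTo-max π zero    zero _   _  = z≤n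
  stateUpTo-max π (suc t) p    p≤T ld with lowDecreasing π (suc (suc t)) in ld′
  ... | true  = p≤T
  ... | false with ℕP.m≤n⇒m<n∨m≡n p≤T
  ...   | inj₁ p<T  = stateUpTo-max π t p (ℕP.≤-pred p<T) ld
  ...   | inj₂ refl with trans (sym ld) ld′
  ...     | ()

  stateUpTo-≤ : ∀ π T → stateUpTo π T ≤ T
  stateUpTo-≤ π zero    = z≤n
  stateUpTo-≤ π (suc t) with lowDecreasing π (suc (suc t))
  ... | true  = ℕP.≤-refl
  ... | false = ℕP.m≤n⇒m≤1+n (stateUpTo-≤ π t)

  state-≤ : ∀ {n π} → IsPerm n π → state π ≤ n
  state-≤ {n} {π} isP = subst (state π ≤_) (length≡ isP) (stateUpTo-≤ π (length π))

  lowDecreasing⇒≤state : ∀ {n π} → IsPerm n π → ∀ {p} → p ≤ n →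
                         lowDecreasing π (suc p) ≡ true → p ≤ state π
  lowDecreasing⇒≤state {n} {π} isP {p} p≤n =
    stateUpTo-max π (length π) p (subst (p ≤_) (sym (length≡ isP)) p≤n)

  ≤state⇒lowDecreasing : ∀ {n π} → IsPerm n π → ∀ {p} → p ≤ state π → lowDecreasing π (suc p) ≡ true
  ≤state⇒lowDecreasing {n} {π} isP p≤ =
    lowDecreasing-mono π (s≤s p≤) (stateUpTo-lowDecreasing π (lowDecreasing-1 isP) (length π))

  state-unique : ∀ {N τ} → IsPerm N τ → ∀ s → s ≤ N → lowDecreasing τ (suc s) ≡ true →
                 (s < N → lowDecreasing τ (suc (suc s)) ≡ false) → state τ ≡ s
  state-unique {N} {τ} isP s s≤N ld ¬ld = ℕP.≤-antisym state≤s (lowDecreasing⇒≤state isP s≤N ld)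
    where
    state≤s : state τ ≤ s
    state≤s with ℕP.m≤n⇒m<n∨m≡n s≤N
    ... | inj₂ refl = state-≤ isP
    ... | inj₁ s<N with state τ ℕ.≤? s
    ...   | yes st≤s = st≤s
    ...   | no  st≰s with trans (sym (≤state⇒lowDecreasing isP (ℕP.≰⇒> st≰s))) (¬ld s<N)
    ...     | ()

  all-snoc : ∀ (q : ℕ → Bool) ys b → all q (ys ++ b ∷ []) ≡ all q ys ∧ q b
  all-snoc q []       b = BP.∧-identityʳ (q b)
  all-snoc q (y ∷ ys) b rewrite all-snoc q ys b = sym (BP.∧-assoc (q y) (all q ys) (q b))

  all-false : ∀ (q : ℕ → Bool) {x xs} → x ∈ xs → q x ≡ false → all q xs ≡ false
  all-false q {xs = y ∷ ys} (here refl) qx rewrite qx = refl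
  all-false q {xs = y ∷ ys} (there x∈)  qx rewrite all-false q x∈ qx = BP.∧-zeroʳ (q y)

  nonIncreasing-snoc : ∀ ys b → nonIncreasing (ys ++ b ∷ []) ≡ nonIncreasing ys ∧ all (λ a → not (a <ᵇ b)) ys
  nonIncreasing-snoc []       b = refl
  nonIncreasing-snoc (y ∷ ys) b rewrite all-snoc (λ c → not (y <ᵇ c)) ys b | nonIncreasing-snoc ys b =
    ∧-interchange (all (λ c → not (y <ᵇ c)) ys) (not (y <ᵇ b))
                  (nonIncreasing ys) (all (λ a → not (a <ᵇ b)) ys)

  nonIncreasing-punchIn : ∀ v ys → nonIncreasing (map (punchIn v) ys) ≡ nonIncreasing ys
  nonIncreasing-punchIn v []       = refl
  nonIncreasing-punchIn v (y ∷ ys) = cong₂ _∧_ (headMax ys) (nonIncreasing-punchIn v ys)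
    where
    headMax : ∀ zs → all (λ b → not (punchIn v y <ᵇ b)) (map (punchIn v) zs) ≡ all (λ b → not (y <ᵇ b)) zs
    headMax []       = refl
    headMax (z ∷ zs) = cong₂ _∧_ (cong not (punchIn-<ᵇ v y z)) (headMax zs)

  filterᵇ-punchIn-≥ : ∀ v w π → v ≤ w →
                      filterᵇ (_<ᵇ suc w) (map (punchIn v) π) ≡ map (punchIn v) (filterᵇ (_<ᵇ w) π)
  filterᵇ-punchIn-≥ v w []      _   = refl
  filterᵇ-punchIn-≥ v w (a ∷ π) v≤w
    rewrite filterᵇ-∷ (_<ᵇ suc w) (punchIn v a) (map (punchIn v) π) | filterᵇ-∷ (_<ᵇ w) a π
    with a ℕ.<? v
  ... | yes a<v rewrite punchIn-< a<v | <ᵇ-true (ℕP.m<n⇒m<1+n (ℕP.<-≤-trans a<v v≤w))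
                      | <ᵇ-true (ℕP.<-≤-trans a<v v≤w) | punchIn-< a<v
    = cong (a ∷_) (filterᵇ-punchIn-≥ v w π v≤w)
  ... | no  a≮v rewrite punchIn-≥ (ℕP.≮⇒≥ a≮v) with a ℕ.<? w
  ...   | yes a<w rewrite <ᵇ-true a<w | punchIn-≥ (ℕP.≮⇒≥ a≮v)
    = cong (suc a ∷_) (filterᵇ-punchIn-≥ v w π v≤w)
  ...   | no  a≮w rewrite <ᵇ-false (ℕP.≮⇒≥ a≮w) = filterᵇ-punchIn-≥ v w π v≤w

  lowDecreasing-insertLast-≥ : ∀ v w π → v ≤ w → lowDecreasing (insertLast v π) (suc w) ≡
    lowDecreasing π w ∧ all (λ a → not (a <ᵇ v)) (map (punchIn v) (filterᵇ (_<ᵇ w) π))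
  lowDecreasing-insertLast-≥ v w π v≤w
    rewrite LP.filter-++ (T? ∘ (_<ᵇ suc w)) (map (punchIn v) π) (v ∷ [])
          | <ᵇ-true {v} {suc w} (s≤s v≤w) | filterᵇ-punchIn-≥ v w π v≤w
          | nonIncreasing-snoc (map (punchIn v) (filterᵇ (_<ᵇ w) π)) v
          | nonIncreasing-punchIn v (filterᵇ (_<ᵇ w) π)
    = refl

  lowDecreasing-insertLast : ∀ v π → lowDecreasing (insertLast v π) v ≡ lowDecreasing π v
  lowDecreasing-insertLast v π
    rewrite LP.filter-++ (T? ∘ (_<ᵇ v)) (map (punchIn v) π) (v ∷ [])
          | <ᵇ-false {v} {v} ℕP.≤-refl | LP.++-identityʳ (filterᵇ (_<ᵇ v) (map (punchIn v) π))
          | Occurrences.filterᵇ-punchIn v π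
    = refl

  lowDecreasing-above-state : ∀ {n π} → IsPerm n π → state π < n →
                              lowDecreasing π (suc (suc (state π))) ≡ false
  lowDecreasing-above-state {n} {π} isP st<n with lowDecreasing π (suc (suc (state π))) in ld
  ... | false = refl
  ... | true  = ⊥-elim (ℕP.<-irrefl refl (lowDecreasing⇒≤state isP st<n ld))

  state-insertLast-1 : ∀ {n π} → IsPerm n π → state (insertLast 1 π) ≡ suc (state π)
  state-insertLast-1 {n} {π} isP =
    state-unique (insertLast-perm isP ℕP.≤-refl (s≤s z≤n)) (suc (state π)) (s≤s (state-≤ isP)) ld ¬ld
    where
    aboveOne : all (λ a → not (a <ᵇ 1)) (map (punchIn 1) (filterᵇ (_<ᵇ suc (state π)) π)) ≡ true
    aboveOne = all⁺ _ positive
      where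
      positive : ∀ {x} → x ∈ map (punchIn 1) (filterᵇ (_<ᵇ suc (state π)) π) → not (x <ᵇ 1) ≡ true
      positive x∈ with ∈-map⁻ (punchIn 1) x∈
      ... | a , a∈ , refl with ∈-range1⁻ (values isP (proj₁ (∈-filterᵇ⁻ (_<ᵇ suc (state π)) a∈)))
      ...   | 1≤a , _ rewrite punchIn-≥ {1} {a} 1≤a = refl
    ld : lowDecreasing (insertLast 1 π) (suc (suc (state π))) ≡ true
    ld rewrite lowDecreasing-insertLast-≥ 1 (suc (state π)) π (s≤s z≤n)
             | ≤state⇒lowDecreasing isP (ℕP.≤-refl {state π}) = aboveOne
    ¬ld : suc (state π) < suc n → lowDecreasing (insertLast 1 π) (suc (suc (suc (state π)))) ≡ false
    ¬ld st<n rewrite lowDecreasing-insertLast-≥ 1 (suc (suc (state π))) π (s≤s z≤n)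
                   | lowDecreasing-above-state isP (ℕP.≤-pred st<n) = refl

  state-insertLast-≤ : ∀ {n π p} → IsPerm n π → 1 ≤ p → p ≤ state π → state (insertLast (suc p) π) ≡ p
  state-insertLast-≤ {n} {π} {p} isP 1≤p p≤st =
    state-unique (insertLast-perm isP (s≤s z≤n) (s≤s p≤n)) p (ℕP.m≤n⇒m≤1+n p≤n) ld ¬ld
    where
    p≤n = ℕP.≤-trans p≤st (state-≤ isP)
    ld : lowDecreasing (insertLast (suc p) π) (suc p) ≡ true
    ld = trans (lowDecreasing-insertLast (suc p) π) (≤state⇒lowDecreasing isP p≤st)
    one∈ : 1 ∈ filterᵇ (_<ᵇ suc p) π
    one∈ = ∈-filterᵇ⁺ (_<ᵇ suc p) (covers isP (∈-range1⁺ ℕP.≤-refl (ℕP.≤-trans 1≤p p≤n)))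
                      (<ᵇ-true (s≤s 1≤p))
    ¬ld : p < suc n → lowDecreasing (insertLast (suc p) π) (suc (suc p)) ≡ false
    ¬ld _ rewrite lowDecreasing-insertLast-≥ (suc p) (suc p) π ℕP.≤-refl
      | all-false (λ a → not (a <ᵇ suc p)) (∈-map⁺ (punchIn (suc p)) one∈)
          (trans (cong (λ z → not (z <ᵇ suc p)) (punchIn-< (s≤s 1≤p))) (cong not (<ᵇ-true (s≤s 1≤p))))
      = BP.∧-zeroʳ _

module GeneratingTree where

  open import Data.Nat using (_+_)
  open Counting
  open Booleans
  open ListFacts
  open Permutations
  open Insertion
  open Occurrences
  open State
  open Walks using (levels; steps; addWeight; weight; continue; walks; walks-suc; walkCount; hasWeight)

  avoiders : ℕ → List (List ℕ)
  avoiders n = filterᵇ (λ π → occ pat123 π ≡ᵇ 0) (perms n)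

  ∈-avoiders⁻ : ∀ {n π} → π ∈ avoiders n → IsPerm n π × occ pat123 π ≡ 0
  ∈-avoiders⁻ π∈ with ∈-filterᵇ⁻ (λ π → occ pat123 π ≡ᵇ 0) π∈
  ... | π∈perms , avoids = ∈-perms⁻ π∈perms , ≡ᵇ-true⁻ avoids

  ∈-avoiders⁺ : ∀ {n π} → IsPerm n π → occ pat123 π ≡ 0 → π ∈ avoiders n
  ∈-avoiders⁺ isP avoids =
    ∈-filterᵇ⁺ (λ π → occ pat123 π ≡ᵇ 0) (∈-perms⁺ isP)
               (subst (λ c → (c ≡ᵇ 0) ≡ true) (sym avoids) refl)

  ∈-levels⁻ : ∀ {p r} → p ∈ levels r → 1 ≤ p × p ≤ r
  ∈-levels⁻ p∈ with ∈-map⁻ suc p∈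
  ... | i , i∈ , refl = s≤s z≤n , ∈-downFrom⁻ i∈

  insertionPoints : ℕ → List ℕ
  insertionPoints r = 0 ∷ levels r

  ∈-insertionPoints⁺ : ∀ {p r} → p ≤ r → p ∈ insertionPoints r
  ∈-insertionPoints⁺ {zero}  _         = here refl
  ∈-insertionPoints⁺ {suc p} p<r = there (∈-map⁺ suc (∈-downFrom⁺ p<r))

  ∈-insertionPoints⁻ : ∀ {p r} → p ∈ insertionPoints r → p ≤ r
  ∈-insertionPoints⁻ (here refl) = z≤n
  ∈-insertionPoints⁻ (there p∈)  = proj₂ (∈-levels⁻ p∈)

  unique-insertionPoints : ∀ r → Unique (insertionPoints r)
  unique-insertionPoints r =
    All.tabulate (λ p∈ 0≡p → ℕP.<-irrefl 0≡p (proj₁ (∈-levels⁻ p∈)))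
    ∷ Unique.map⁺ ℕP.suc-injective (Unique.downFrom⁺ r)

  children : List ℕ → List (List ℕ)
  children π = map (λ p → insertLast (suc p) π) (insertionPoints (state π))

  unique-children : ∀ {πs} → Unique πs → Unique (concatMap children πs)
  unique-children uπs = unique-concatMap children uπs
    (λ π → Unique.map⁺ (λ eq → ℕP.suc-injective (proj₁ (insertLast-injective eq)))
                       (unique-insertionPoints (state π)))
    (λ {π} {π′} τ∈ τ∈′ → case ∈-map⁻ _ τ∈ , ∈-map⁻ _ τ∈′ of λ
      { ((_ , _ , refl) , (_ , _ , eq)) → proj₂ (insertLast-injective eq) })

  -- τ avoids 123 iff its parent does and the values below its last entry avoid 12.
  avoiders-suc-⊆ : ∀ n → avoiders (suc n) ⊆ concatMap children (avoiders n)
  avoiders-suc-⊆ n τ∈ with ∈-avoiders⁻ {suc n} τ∈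
  ... | isPτ , τ-avoids with removeLast isPτ
  ... | suc p , π , refl , isPπ , _ , p<n =
    ∈-concatMap⁺ children
      (Any.map (λ { refl → ∈-map⁺ (λ p → insertLast (suc p) π) p∈ }) (∈-avoiders⁺ {n} isPπ π-avoids))
    where
    both≡0 = trans (sym (occ123-insertLast (suc p) π)) τ-avoids
    π-avoids : occ pat123 π ≡ 0
    π-avoids = ℕP.m+n≡0⇒m≡0 (occ pat123 π) both≡0
    p∈ : p ∈ insertionPoints (state π)
    p∈ = ∈-insertionPoints⁺ (lowDecreasing⇒≤state isPπ (ℕP.≤-pred p<n)
           (occ12≡0⇒nonIncreasing (filterᵇ (_<ᵇ suc p) π) (ℕP.m+n≡0⇒n≡0 (occ pat123 π) both≡0)))

  children-⊆-avoiders : ∀ n → concatMap children (avoiders n) ⊆ avoiders (suc n)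
  children-⊆-avoiders n τ∈ with find (∈-concatMap⁻ children {xs = avoiders n} τ∈)
  ... | π , π∈ , τ∈children
    with ∈-avoiders⁻ {n} π∈ | ∈-map⁻ (λ p → insertLast (suc p) π) τ∈children
  ... | isPπ , π-avoids | p , p∈ , refl = ∈-avoiders⁺ {suc n} (insertLast-perm isPπ (s≤s z≤n) (s≤s p≤n))
    (trans (occ123-insertLast (suc p) π)
      (cong₂ _+_ π-avoids (nonIncreasing⇒occ12≡0 (filterᵇ (_<ᵇ suc p) π) (≤state⇒lowDecreasing isPπ p≤st))))
    where
    p≤st = ∈-insertionPoints⁻ p∈
    p≤n = ℕP.≤-trans p≤st (state-≤ isPπ)

  avoiders-suc-↭ : ∀ n → avoiders (suc n) ↭ concatMap children (avoiders n)
  avoiders-suc-↭ n = ↭-fromMembers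
    (Unique.filter⁺ _ (unique-perms (suc n)))
    (unique-children (Unique.filter⁺ _ (unique-perms n)))
    (avoiders-suc-⊆ n) (children-⊆-avoiders n)

  label : ℕ → List ℕ → ℕ × ℕ
  label k π = state π , occ (patK k) π

  label-children : ∀ j {n π} → IsPerm n π → let k = suc (suc j) in
    map (label k) (children π) ≡ map (addWeight (occ (patK k) π)) (steps k (state π))
  label-children j {n} {π} isP = cong₂ _∷_
    (cong₂ _,_ (state-insertLast-1 isP) (occK-insertLast (suc j) isP z≤n (lowDecreasing-1 isP)))
    (begin
      map (label k) (map (λ p → insertLast (suc p) π) (levels (state π)))
        ≡⟨ LP.map-∘ (levels (state π)) ⟨
      map (label k ∘ (λ p → insertLast (suc p) π)) (levels (state π))
        ≡⟨ map-cong-∈ (levels (state π)) (λ p∈ → label-child (∈-levels⁻ p∈)) ⟩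
      map (addWeight (occ (patK k) π) ∘ (λ p → p , weight k p)) (levels (state π))
        ≡⟨ LP.map-∘ (levels (state π)) ⟩
      map (addWeight (occ (patK k) π)) (map (λ p → p , weight k p) (levels (state π))) ∎)
    where
    open ≡-Reasoning
    k = suc (suc j)
    label-child : ∀ {p} → 1 ≤ p × p ≤ state π →
                  label k (insertLast (suc p) π) ≡ addWeight (occ (patK k) π) (p , weight k p)
    label-child (1≤p , p≤st) = cong₂ _,_ (state-insertLast-≤ isP 1≤p p≤st)
      (occK-insertLast (suc j) isP (ℕP.≤-trans p≤st (state-≤ isP)) (≤state⇒lowDecreasing isP p≤st))

  labels-↭-walks : ∀ j n → let k = suc (suc j) in map (label k) (avoiders n) ↭ walks k 0 n
  labels-↭-walks j zero    = ↭-refl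
  labels-↭-walks j (suc n) = begin
    map (label k) (avoiders (suc n))
      ↭⟨ ↭.map⁺ (label k) (avoiders-suc-↭ n) ⟩
    map (label k) (concatMap children (avoiders n))
      ≡⟨ LP.map-concatMap (label k) children (avoiders n) ⟩
    concatMap (map (label k) ∘ children) (avoiders n)
      ≡⟨ cong concat (map-cong-∈ (avoiders n) (λ π∈ → label-children j (proj₁ (∈-avoiders⁻ {n} π∈)))) ⟩
    concatMap (λ π → map (addWeight (occ (patK k) π)) (steps k (state π))) (avoiders n)
      ≡⟨ LP.concatMap-map _ (label k) (avoiders n) ⟨
    continue (steps k) (map (label k) (avoiders n))
      ↭⟨ concatMap-↭ _ (labels-↭-walks j n) ⟩
    continue (steps k) (walks k 0 n)
      ≡⟨ walks-suc k 0 n ⟨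
    walks k 0 (suc n) ∎
    where
    open PermutationReasoning
    k = suc (suc j)

  count≡walkCount : ∀ j n m → count (suc (suc j)) n m ≡ walkCount (suc (suc j)) 0 n m
  count≡walkCount j n m = begin
    countᵇ (λ π → (occ pat123 π ≡ᵇ 0) ∧ (occ (patK k) π ≡ᵇ m)) (perms n)
      ≡⟨ countᵇ-∧ (λ π → occ pat123 π ≡ᵇ 0) (λ π → occ (patK k) π ≡ᵇ m) (perms n) ⟩
    countᵇ (hasWeight m ∘ label k) (avoiders n)
      ≡⟨ countᵇ-map (hasWeight m) (label k) (avoiders n) ⟨
    countᵇ (hasWeight m) (map (label k) (avoiders n))
      ≡⟨ countᵇ-↭ (hasWeight m) (labels-↭-walks j n) ⟩
    countᵇ (hasWeight m) (walks k 0 n) ∎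
    where
    open ≡-Reasoning
    k = suc (suc j)

open import Data.Integer using (+_)
open ContinuedFraction using (cf≡A₀)
open WalkSeries
open GeneratingTree using (count≡walkCount)

theorem8 : (k : ℕ) → 2 ≤ k → (n m d : ℕ) → n < d →
           cf k d 0 n m ≡ + count k n m
theorem8 (suc (suc j)) (s≤s (s≤s z≤n)) n m d n<d = begin
  cf k d 0 n m
    ≡⟨ cf≡A₀ k refl (walkSeries k) (walkSeries-zero k) (walkSeries₀-suc k) (walkSeries-suc k) n m d n<d ⟩
  walkSeries k 0 n m
    ≡⟨ cong +_ (count≡walkCount j n m) ⟨
  + count k n m ∎
  where
  open ≡-Reasoning
  k = suc (suc j)
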